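{- For any nonempty finite set $S$ of positive integers (not depending on $n$), with $m=\max S$, the coefficient $C^S_0$ of $\binom{n-m}{0}$ in the expansion $p(S;n)=\sum_{k\ge0}C^S_k\binom{n-m}{k}$ equals $0$.
   Context: For a permutation $\pi=a_1\ldots a_n$ of $\{1,\ldots,n\}$, an index $i$ is a peak if $a_{i-1}<a_i>a_{i+1}$. $P(S;n)$ is the set of permutations of $\{1,\dots,n\}$ whose set of peaks is exactly $S$. $S$ is admissible if $\#P(S;n)\ne0$ for some $n$; then the peak polynomial $p(S;n)$ is the unique polynomial with $\#P(S;n)=p(S;n)2^{n-\#S-1}$ for all $n>\max S$; if $S$ is not admissible, $p(S;n)$ is the zero polynomial. The coefficients $C^S_k$ are defined by $p(S;n)=\sum_{k\ge 0}C^S_k\binom{n-m}{k}$ with $m=\max S$. -}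

module Defs where

open import Data.Nat using (ℕ; zero; suc; _+_; _∸_; _<_; _<?_; _⊔_)
open import Data.Nat.Combinatorics using (_C_)
open import Data.Integer using (+_)
open import Data.Rational using (ℚ; _/_; 0ℚ) renaming (_+_ to _+ℚ_; _*_ to _*ℚ_)
open import Data.List using (List; []; _∷_; concatMap; filter; length; foldr)
open import Data.List.Properties using (≡-dec)
open import Data.List.Relation.Unary.All using (All)
open import Data.List.Relation.Unary.AllPairs using (AllPairs)
open import Data.Bool using (Bool; true; false; _∧_; if_then_else_)
open import Relation.Nullary.Decidable using (⌊_⌋)
import Data.Nat as ℕ

toℚ : ℕ → ℚ
toℚ n = (+ n) / 1

insertions : ℕ → List ℕ → List (List ℕ)
insertions x [] = (x ∷ []) ∷ []
insertions x (y ∷ ys) = (x ∷ y ∷ ys) ∷ Data.List.map (y ∷_) (insertions x ys)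

-- all permutations of {1,...,n}, as one-line words a_1 ... a_n (each exactly once)
perms : ℕ → List (List ℕ)
perms zero = [] ∷ []
perms (suc n) = concatMap (insertions (suc n)) (perms n)

-- peaksFrom i w : peaks of w where the first letter of w has (1-based) index i
peaksFrom : ℕ → List ℕ → List ℕ
peaksFrom i (a ∷ b ∷ c ∷ rest) =
  if ⌊ a <? b ⌋ ∧ ⌊ c <? b ⌋
  then suc i ∷ peaksFrom (suc i) (b ∷ c ∷ rest)
  else peaksFrom (suc i) (b ∷ c ∷ rest)
peaksFrom i _ = []

-- peak set of a permutation (increasing list of 1-based indices i with a_{i-1} < a_i > a_{i+1})
peaks : List ℕ → List ℕ
peaks w = peaksFrom 1 w

-- #P(S;n): number of permutations of {1..n} whose peak set is exactly S
-- (S given as a strictly increasing list)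
countP : List ℕ → ℕ → ℕ
countP S n = length (filter (λ w → ≡-dec ℕ._≟_ (peaks w) S) (perms n))

IsFinSetPos : List ℕ → Set
IsFinSetPos S = AllPairs _<_ S × All (0 <_) S
  where open import Data.Product using (_×_)

maxL : List ℕ → ℕ
maxL = foldr _⊔_ 0

evalBinomFrom : ℕ → List ℚ → ℕ → ℚ
evalBinomFrom k [] x = 0ℚ
evalBinomFrom k (c ∷ cs) x = (c *ℚ toℚ (x C k)) +ℚ evalBinomFrom (suc k) cs x

evalBinom : List ℚ → ℕ → ℚ
evalBinom = evalBinomFrom 0

-- k-th coefficient (0 beyond the list)
coeff : List ℚ → ℕ → ℚ
coeff [] k = 0ℚ
coeff (c ∷ cs) zero = c
coeff (c ∷ cs) (suc k) = coeff cs k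

module Submission where

-- The hypothesis says #P(S;n) = 2^(n−|S|−1)·Σₖ Cₖ·(n−m choose k)
-- for n > m = max S; the point is that this identity persists at n = m, where the left side
-- is 0 (m cannot be a peak of a permutation of length m) and the right side is 2^(m−|S|−1)·C₀.
--
-- Both sides are sequences annihilated by a power of Δ q n = q (n+1) − 2 q n, and such a
-- sequence vanishing at 1, 2, 3, … vanishes at 0 (module Annihilation).  For the binomial
-- expansion this is Pascal's rule (BinomialExpansions).  For n ↦ #P(S;n) it is the
-- combinatorial heart: encode S by the bit pattern σ of its peaks (PeakWords, PeakSets) and
-- count permutations whose peak word matches σ.  Inserting the largest letter n+1 into a
-- permutation of {1,…,n} (InsertingTheLargestLetter) gives a recurrence
-- count σ (n+1) = 2·count σ n + (counts of shorter patterns), so by induction on σ every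
-- count is annihilated from |σ|+1 = m (CountsAreAnnihilated).  ConstantCoefficient combines
-- these, treating separately the degenerate case min S < 2, where #P(S;n) = 0 for all n.

open import Defs
open import Data.Nat using (ℕ; _∸_; _<_; _^_; _≤?_)
open import Data.List using (List; []; _∷_; length)
open import Data.Rational using (ℚ; 0ℚ) renaming (_*_ to _*ℚ_)
open import Relation.Binary.PropositionalEquality using (_≡_; _≢_; refl)
open import Data.Product using (_,_)
open import Data.Empty using (⊥-elim)
open import Relation.Nullary using (yes; no)

module NatToRational where
  open import Data.Nat as ℕ using (suc)
  import Data.Nat.Properties as ℕP
  open import Data.Nat.Coprimality using (1-coprimeTo) renaming (sym to coprime-sym)
  open import Data.Integer as ℤ using (+_)
  import Data.Integer.Properties as ℤP
  open import Data.Sign.Base using (Sign)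
  open import Data.Rational as ℚ using (mkℚ; _+_; _*_; NonZero)
  import Data.Rational.Properties as ℚP
  open import Relation.Binary.PropositionalEquality

  toℚ-normal : ∀ n → toℚ n ≡ mkℚ (+ n) 0 (coprime-sym (1-coprimeTo n))
  toℚ-normal n = ℚP.normalize-coprime (coprime-sym (1-coprimeTo n))

  -- The numerator +n·1 arising in sums and products of normal forms n/1.
  +◃n*1 : ∀ n → Sign.+ ℤ.◃ (n ℕ.* 1) ≡ + n
  +◃n*1 n = trans (cong (Sign.+ ℤ.◃_) (ℕP.*-identityʳ n)) (ℤP.+◃n≡+n n)

  toℚ-+ : ∀ a b → toℚ (a ℕ.+ b) ≡ toℚ a + toℚ b
  toℚ-+ a b = sym (trans (cong₂ _+_ (toℚ-normal a) (toℚ-normal b))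
                         (cong₂ (λ x y → (x ℤ.+ y) ℚ./ 1) (+◃n*1 a) (+◃n*1 b)))

  toℚ-* : ∀ a b → toℚ (a ℕ.* b) ≡ toℚ a * toℚ b
  toℚ-* a b = sym (trans (cong₂ _*_ (toℚ-normal a) (toℚ-normal b))
                         (cong (ℚ._/ 1) (ℤP.+◃n≡+n (a ℕ.* b))))

  toℚ-nonZero : ∀ n → ℕ.NonZero n → NonZero (toℚ n)
  toℚ-nonZero (suc n) _ rewrite toℚ-normal (suc n) = _

  *-cancel-nonZero : ∀ c y → NonZero c → c * y ≡ 0ℚ → y ≡ 0ℚ
  *-cancel-nonZero c y c≢0 c*y≡0 = begin
    y              ≡⟨ sym (ℚP.*-identityˡ y) ⟩
    ℚ.1ℚ * y       ≡⟨ cong (_* y) (sym (ℚP.*-inverseˡ c {{c≢0}})) ⟩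
    (c⁻¹ * c) * y  ≡⟨ ℚP.*-assoc c⁻¹ c y ⟩
    c⁻¹ * (c * y)  ≡⟨ cong (c⁻¹ *_) c*y≡0 ⟩
    c⁻¹ * 0ℚ       ≡⟨ ℚP.*-zeroʳ c⁻¹ ⟩
    0ℚ             ∎
    where
    open ≡-Reasoning
    c⁻¹ : ℚ
    c⁻¹ = ℚ.1/_ c {{c≢0}}

  2^-cancel : ∀ j y → toℚ (2 ^ j) * y ≡ 0ℚ → y ≡ 0ℚ
  2^-cancel j y = *-cancel-nonZero (toℚ (2 ^ j)) y (toℚ-nonZero (2 ^ j) (ℕP.m^n≢0 2 j))

-- Sequences q : ℕ → ℚ annihilated, from some index on, by a power of the operator
-- Δ q n = q (n+1) − 2·q n.  These are the sequences that eventually have the form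
-- 2ⁿ · (polynomial in n); the class is closed under the operations below.
module Annihilation where
  open import Data.Nat as ℕ using (zero; suc; _≤_; z≤n; s≤s)
  import Data.Nat.Properties as ℕP
  open import Data.Rational as ℚ using (_+_; _*_; _-_; -_)
  import Data.Rational.Properties as ℚP
  open import Data.Rational.Solver using (module +-*-Solver)
  open +-*-Solver using (solve; _:+_; _:*_; _:-_; :-_; _:=_; con)
  open import Data.Product using (∃; _,_)
  open import Data.List using (_∷_; map)
  open import Data.Nat.ListAction using (sum)
  open import Data.List.Relation.Unary.All using (All; []; _∷_)
  open import Relation.Binary.PropositionalEquality
  open NatToRational

  Δ : (ℕ → ℚ) → ℕ → ℚ
  Δ q n = q (suc n) - (q n + q n)

  Δ^ : ℕ → (ℕ → ℚ) → ℕ → ℚ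
  Δ^ zero    q = q
  Δ^ (suc k) q = Δ^ k (Δ q)

  Annihilated : (ℕ → ℚ) → ℕ → Set
  Annihilated q a = ∃ λ k → ∀ n → a ≤ n → Δ^ k q n ≡ 0ℚ

  Δ^-congFrom : ∀ {q r} a → (∀ n → a ≤ n → q n ≡ r n) → ∀ k n → a ≤ n → Δ^ k q n ≡ Δ^ k r n
  Δ^-congFrom         a q≡r zero    n a≤n = q≡r n a≤n
  Δ^-congFrom {q} {r} a q≡r (suc k) n a≤n = Δ^-congFrom a Δq≡Δr k n a≤n
    where
    Δq≡Δr : ∀ m → a ≤ m → Δ q m ≡ Δ r m
    Δq≡Δr m a≤m = cong₂ _-_ (q≡r (suc m) (ℕP.m≤n⇒m≤1+n a≤m))
                            (cong₂ _+_ (q≡r m a≤m) (q≡r m a≤m))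

  Δ^-zero : ∀ k n → Δ^ k (λ _ → 0ℚ) n ≡ 0ℚ
  Δ^-zero zero    n = refl
  Δ^-zero (suc k) n = Δ^-zero k n

  Δ^-+ : ∀ (q r : ℕ → ℚ) k n → Δ^ k (λ m → q m + r m) n ≡ Δ^ k q n + Δ^ k r n
  Δ^-+ q r zero    n = refl
  Δ^-+ q r (suc k) n =
    trans (Δ^-congFrom 0 (λ m _ → linear (q (suc m)) (r (suc m)) (q m) (r m)) k n z≤n)
          (Δ^-+ (Δ q) (Δ r) k n)
    where
    linear : ∀ a b c d → (a + b) - ((c + d) + (c + d)) ≡ (a - (c + c)) + (b - (d + d))
    linear = solve 4 (λ a b c d → (a :+ b) :- ((c :+ d) :+ (c :+ d))
                                 := (a :- (c :+ c)) :+ (b :- (d :+ d))) refl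

  Δ^-scale : ∀ c (q : ℕ → ℚ) k n → Δ^ k (λ m → c * q m) n ≡ c * Δ^ k q n
  Δ^-scale c q zero    n = refl
  Δ^-scale c q (suc k) n =
    trans (Δ^-congFrom 0 (λ m _ → linear c (q (suc m)) (q m)) k n z≤n) (Δ^-scale c (Δ q) k n)
    where
    linear : ∀ c a b → (c * a) - ((c * b) + (c * b)) ≡ c * (a - (b + b))
    linear = solve 3 (λ c a b → (c :* a) :- ((c :* b) :+ (c :* b)) := c :* (a :- (b :+ b))) refl

  Δ^-shift : ∀ k (q : ℕ → ℚ) a n → Δ^ k (λ x → q (x ℕ.+ a)) n ≡ Δ^ k q (n ℕ.+ a)
  Δ^-shift zero    q a n = refl
  Δ^-shift (suc k) q a n = Δ^-shift k (Δ q) a n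

  annihilated-raise : ∀ {q a} k → (∀ n → a ≤ n → Δ^ k q n ≡ 0ℚ) →
                      ∀ j n → a ≤ n → Δ^ (k ℕ.+ j) q n ≡ 0ℚ
  annihilated-raise zero    Δ^kq≡0 j n a≤n =
    trans (Δ^-congFrom _ Δ^kq≡0 j n a≤n) (Δ^-zero j n)
  annihilated-raise (suc k) Δ^kq≡0 j n a≤n = annihilated-raise k Δ^kq≡0 j n a≤n

  annihilated-zero : ∀ {q} a → (∀ n → a ≤ n → q n ≡ 0ℚ) → Annihilated q a
  annihilated-zero a q≡0 = 0 , q≡0

  annihilated-mono : ∀ {q a b} → a ≤ b → Annihilated q a → Annihilated q b
  annihilated-mono a≤b (k , Δ^kq≡0) = k , λ n b≤n → Δ^kq≡0 n (ℕP.≤-trans a≤b b≤n)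

  annihilated-cong : ∀ {q r a} → (∀ n → a ≤ n → q n ≡ r n) → Annihilated q a → Annihilated r a
  annihilated-cong {a = a} q≡r (k , Δ^kq≡0) =
    k , λ n a≤n → trans (sym (Δ^-congFrom a q≡r k n a≤n)) (Δ^kq≡0 n a≤n)

  annihilated-+ : ∀ {q r a} → Annihilated q a → Annihilated r a → Annihilated (λ n → q n + r n) a
  annihilated-+ {q} {r} (k , Δ^kq≡0) (l , Δ^lr≡0) = k ℕ.+ l , λ n a≤n → begin
    Δ^ (k ℕ.+ l) (λ m → q m + r m) n       ≡⟨ Δ^-+ q r (k ℕ.+ l) n ⟩
    Δ^ (k ℕ.+ l) q n + Δ^ (k ℕ.+ l) r n    ≡⟨ cong (Δ^ (k ℕ.+ l) q n +_) (cong (λ j → Δ^ j r n) (ℕP.+-comm k l)) ⟩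
    Δ^ (k ℕ.+ l) q n + Δ^ (l ℕ.+ k) r n    ≡⟨ cong₂ _+_ (annihilated-raise k Δ^kq≡0 l n a≤n)
                                                         (annihilated-raise l Δ^lr≡0 k n a≤n) ⟩
    0ℚ                                     ∎
    where open ≡-Reasoning

  annihilated-scale : ∀ {q a} c → Annihilated q a → Annihilated (λ n → c * q n) a
  annihilated-scale {q} c (k , Δ^kq≡0) =
    k , λ n a≤n → trans (Δ^-scale c q k n) (trans (cong (c *_) (Δ^kq≡0 n a≤n)) (ℚP.*-zeroʳ c))

  annihilated-Δ : ∀ {q r a} → (∀ n → a ≤ n → Δ q n ≡ r n) → Annihilated r a → Annihilated q a
  annihilated-Δ {a = a} Δq≡r (k , Δ^kr≡0) =
    suc k , λ n a≤n → trans (Δ^-congFrom a Δq≡r k n a≤n) (Δ^kr≡0 n a≤n)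

  annihilated-shift : ∀ {q} a → Annihilated q a → Annihilated (λ x → q (x ℕ.+ a)) 0
  annihilated-shift {q} a (k , Δ^kq≡0) =
    k , λ n _ → trans (Δ^-shift k q a n) (Δ^kq≡0 (n ℕ.+ a) (ℕP.m≤n+m a n))

  annihilated-sum : ∀ {A : Set} (g : A → ℕ → ℕ) (τs : List A) a →
    All (λ τ → Annihilated (λ n → toℚ (g τ n)) a) τs →
    Annihilated (λ n → toℚ (sum (map (λ τ → g τ n) τs))) a
  annihilated-sum g []       a []       = annihilated-zero a (λ _ _ → refl)
  annihilated-sum g (τ ∷ τs) a (gτ ∷ gτs) =
    annihilated-cong (λ n _ → sym (toℚ-+ (g τ n) _)) (annihilated-+ gτ (annihilated-sum g τs a gτs))

  annihilated-recurrence : ∀ (f g : ℕ → ℕ) a →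
    (∀ n → a ≤ n → f (suc n) ≡ (f n ℕ.+ f n) ℕ.+ g n) →
    Annihilated (λ n → toℚ (g n)) a → Annihilated (λ n → toℚ (f n)) a
  annihilated-recurrence f g a rec = annihilated-Δ Δf≡g
    where
    cancel : ∀ x s → (x + x + s) - (x + x) ≡ s
    cancel = solve 2 (λ x s → (x :+ x :+ s) :- (x :+ x) := s) refl
    Δf≡g : ∀ n → a ≤ n → Δ (λ m → toℚ (f m)) n ≡ toℚ (g n)
    Δf≡g n a≤n = begin
      toℚ (f (suc n)) - (toℚ (f n) + toℚ (f n))
        ≡⟨ cong (λ z → toℚ z - (toℚ (f n) + toℚ (f n))) (rec n a≤n) ⟩
      toℚ ((f n ℕ.+ f n) ℕ.+ g n) - (toℚ (f n) + toℚ (f n))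
        ≡⟨ cong (_- (toℚ (f n) + toℚ (f n)))
                (trans (toℚ-+ (f n ℕ.+ f n) (g n)) (cong (_+ toℚ (g n)) (toℚ-+ (f n) (f n)))) ⟩
      (toℚ (f n) + toℚ (f n) + toℚ (g n)) - (toℚ (f n) + toℚ (f n))
        ≡⟨ cancel (toℚ (f n)) (toℚ (g n)) ⟩
      toℚ (g n) ∎
      where open ≡-Reasoning

  -- An annihilated sequence is determined by its values at 1, 2, 3, ...: if these vanish,
  -- so does the value at 0 (each Δ-step halves the problem: q 1 − 2 q 0 = 0).
  vanishing : ∀ (q : ℕ → ℚ) k → (∀ n → Δ^ k q n ≡ 0ℚ) → (∀ x → 1 ≤ x → q x ≡ 0ℚ) → q 0 ≡ 0ℚ
  vanishing q zero    Δ^kq≡0 q≡0 = Δ^kq≡0 0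
  vanishing q (suc k) Δ^kq≡0 q≡0 = halve (q 0) (trans (cong (_- (q 0 + q 0)) (sym (q≡0 1 (s≤s z≤n)))) Δq0≡0)
    where
    halve : ∀ x → 0ℚ - (x + x) ≡ 0ℚ → x ≡ 0ℚ
    halve x eq = trans (solve 1 (λ x → x := (:- con ℚ.½) :* (con 0ℚ :- (x :+ x))) refl x)
                       (cong ((- ℚ.½) *_) eq)
    Δq≡0 : ∀ x → 1 ≤ x → Δ q x ≡ 0ℚ
    Δq≡0 x 1≤x = cong₂ _-_ (q≡0 (suc x) (s≤s z≤n)) (cong₂ _+_ (q≡0 x 1≤x) (q≡0 x 1≤x))
    Δq0≡0 : Δ q 0 ≡ 0ℚ
    Δq0≡0 = vanishing (Δ q) k Δ^kq≡0 Δq≡0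

-- The right-hand side of the theorem: x ↦ 2ˣ · Σₖ Cₖ·(x choose k) is annihilated by Δ^(length C),
-- since Pascal's rule turns Δ into the shift C₀ ∷ C₁ ∷ … ↦ C₁ ∷ C₂ ∷ … (up to a factor 2).
module BinomialExpansions where
  open import Data.Nat as ℕ using (zero; suc; _≤_; z≤n)
  open import Data.Nat.Combinatorics using (_C_; nCk+nC[k+1]≡[n+1]C[k+1])
  open import Data.Rational using (1ℚ; _+_; _*_; _-_; -_; NonZero)
  import Data.Rational.Properties as ℚP
  open import Data.Rational.Solver using (module +-*-Solver)
  open +-*-Solver using (solve; _:+_; _:*_; _:-_; :-_; _:=_; con)
  open import Data.List using (_∷_)
  open import Data.Product using (proj₁; proj₂)
  open import Relation.Binary.PropositionalEquality
  open NatToRational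
  open Annihilation

  evalBinomFrom-pascal : ∀ k cs x →
    evalBinomFrom (suc k) cs (suc x) ≡ evalBinomFrom k cs x + evalBinomFrom (suc k) cs x
  evalBinomFrom-pascal k []       x = refl
  evalBinomFrom-pascal k (c ∷ cs) x = begin
      c * toℚ (suc x C suc k) + evalBinomFrom (suc (suc k)) cs (suc x)
    ≡⟨ cong₂ (λ u v → c * u + v)
             (trans (cong toℚ (sym (nCk+nC[k+1]≡[n+1]C[k+1] x k))) (toℚ-+ (x C k) (x C suc k)))
             (evalBinomFrom-pascal (suc k) cs x) ⟩
      c * (toℚ (x C k) + toℚ (x C suc k)) + (evalBinomFrom (suc k) cs x + evalBinomFrom (suc (suc k)) cs x)
    ≡⟨ regroup c (toℚ (x C k)) (toℚ (x C suc k)) (evalBinomFrom (suc k) cs x) (evalBinomFrom (suc (suc k)) cs x) ⟩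
      (c * toℚ (x C k) + evalBinomFrom (suc k) cs x) + (c * toℚ (x C suc k) + evalBinomFrom (suc (suc k)) cs x)
    ∎
    where
    open ≡-Reasoning
    regroup : ∀ c a b u v → c * (a + b) + (u + v) ≡ (c * a + u) + (c * b + v)
    regroup = solve 5 (λ c a b u v → c :* (a :+ b) :+ (u :+ v) := (c :* a :+ u) :+ (c :* b :+ v)) refl

  x-choose-0 : ∀ x → x C 0 ≡ 1
  x-choose-0 zero    = refl
  x-choose-0 (suc x) = refl

  expBinom : List ℚ → ℕ → ℚ
  expBinom cs x = evalBinom cs x * toℚ (2 ^ x)

  Δ-expBinom : ∀ c cs n → Δ (expBinom (c ∷ cs)) n ≡ toℚ 2 * expBinom cs n
  Δ-expBinom c cs n = begin
      (c * toℚ (suc n C 0) + evalBinomFrom 1 cs (suc n)) * toℚ (2 ^ suc n) - (e n + e n)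
    ≡⟨ cong₂ (λ u w → (c * toℚ (suc n C 0) + u) * w - (e n + e n))
             (evalBinomFrom-pascal 0 cs n) (toℚ-* 2 (2 ^ n)) ⟩
      (c * toℚ (suc n C 0) + (evalBinom cs n + tail)) * (toℚ 2 * p) - (e n + e n)
    ≡⟨ cong₂ (λ u w → (c * toℚ u + (evalBinom cs n + tail)) * (toℚ 2 * p)
                       - ((c * toℚ w + tail) * p + (c * toℚ w + tail) * p))
             (x-choose-0 (suc n)) (x-choose-0 n) ⟩
      (c * 1ℚ + (evalBinom cs n + tail)) * ((1ℚ + 1ℚ) * p) - ((c * 1ℚ + tail) * p + (c * 1ℚ + tail) * p)
    ≡⟨ cancel c (evalBinom cs n) tail p ⟩
      (1ℚ + 1ℚ) * (evalBinom cs n * p)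
    ∎
    where
    open ≡-Reasoning
    e = expBinom (c ∷ cs)
    tail = evalBinomFrom 1 cs n
    p = toℚ (2 ^ n)
    cancel : ∀ c a b p → (c * 1ℚ + (a + b)) * ((1ℚ + 1ℚ) * p) - ((c * 1ℚ + b) * p + (c * 1ℚ + b) * p)
                         ≡ (1ℚ + 1ℚ) * (a * p)
    cancel = solve 4 (λ c a b p → (c :* con 1ℚ :+ (a :+ b)) :* ((con 1ℚ :+ con 1ℚ) :* p)
                                  :- ((c :* con 1ℚ :+ b) :* p :+ (c :* con 1ℚ :+ b) :* p)
                                  := (con 1ℚ :+ con 1ℚ) :* (a :* p)) refl

  expBinom-annihilated : ∀ cs → Annihilated (expBinom cs) 0
  expBinom-annihilated []       = annihilated-zero 0 (λ n _ → ℚP.*-zeroˡ (toℚ (2 ^ n)))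
  expBinom-annihilated (c ∷ cs) =
    annihilated-Δ (λ n _ → Δ-expBinom c cs n) (annihilated-scale (toℚ 2) (expBinom-annihilated cs))

  expBinom-0 : ∀ cs → expBinom cs 0 ≡ coeff cs 0
  expBinom-0 []       = refl
  expBinom-0 (c ∷ cs) = trans (cong (λ t → (c * 1ℚ + t) * 1ℚ) (tail-0 cs 0)) (simplify c)
    where
    tail-0 : ∀ cs k → evalBinomFrom (suc k) cs 0 ≡ 0ℚ
    tail-0 []       k = refl
    tail-0 (d ∷ ds) k = trans (cong (d * 0ℚ +_) (tail-0 ds (suc k)))
                              (trans (ℚP.+-identityʳ (d * 0ℚ)) (ℚP.*-zeroʳ d))
    simplify : ∀ c → (c * 1ℚ + 0ℚ) * 1ℚ ≡ c
    simplify = solve 1 (λ c → (c :* con 1ℚ :+ con 0ℚ) :* con 1ℚ := c) refl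

  -- Let f be annihilated from m with f m = 0, and suppose
  -- f (m + x) = c · 2ˣ · Σₖ Cₖ·(x choose k) for all x ≥ 1, with c ≠ 0.  Then C₀ = 0:
  -- the difference of the two sides is annihilated from 0 and vanishes for x ≥ 1, hence at 0.
  constant-coefficient-zero : ∀ (f : ℕ → ℚ) m (cs : List ℚ) c → NonZero c →
    Annihilated f m → f m ≡ 0ℚ → (∀ x → 1 ≤ x → f (x ℕ.+ m) ≡ c * expBinom cs x) → coeff cs 0 ≡ 0ℚ
  constant-coefficient-zero f m cs c c≢0 f-ann fm≡0 f≡cE =
    trans (sym (expBinom-0 cs)) (*-cancel-nonZero c (expBinom cs 0) c≢0 cE0≡0)
    where
    h : ℕ → ℚ
    h x = f (x ℕ.+ m) + (- c) * expBinom cs x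
    h-ann : Annihilated h 0
    h-ann = annihilated-+ (annihilated-shift m f-ann) (annihilated-scale (- c) (expBinom-annihilated cs))
    difference : ∀ a b → a + (- c) * b ≡ a - c * b
    difference a b = cong (a +_) (sym (ℚP.neg-distribˡ-* c b))
    h≡0 : ∀ x → 1 ≤ x → h x ≡ 0ℚ
    h≡0 x 1≤x = trans (difference (f (x ℕ.+ m)) (expBinom cs x))
                      (trans (cong (_- c * expBinom cs x) (f≡cE x 1≤x)) (ℚP.+-inverseʳ (c * expBinom cs x)))
    h0≡0 : h 0 ≡ 0ℚ
    h0≡0 = vanishing h (proj₁ h-ann) (λ n → proj₂ h-ann n z≤n) h≡0
    cE0≡0 : c * expBinom cs 0 ≡ 0ℚ
    cE0≡0 = negate-zero (c * expBinom cs 0)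
      (trans (cong (_- c * expBinom cs 0) (sym fm≡0)) (trans (sym (difference (f m) _)) h0≡0))
      where
      negate-zero : ∀ y → 0ℚ - y ≡ 0ℚ → y ≡ 0ℚ
      negate-zero y eq = trans (solve 1 (λ y → y := :- (con 0ℚ :- y)) refl y) (cong -_ eq)

module Sums where
  open import Data.Nat using (_+_)
  import Data.Nat.Properties as ℕP
  open import Algebra.Properties.CommutativeSemigroup ℕP.+-commutativeSemigroup using (interchange)
  open import Data.Nat.ListAction using (sum)
  open import Data.Nat.ListAction.Properties using (sum-++)
  open import Data.Bool using (Bool; true; false; if_then_else_)
  open import Data.List using (_∷_; map; _++_; concatMap; filter)
  open import Data.List.Properties using (map-++; map-cong-local)
  open import Data.Product using (_×_; proj₁; proj₂)
  open import Relation.Nullary using (¬_; yes; no)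
  open import Relation.Unary using (Decidable)
  open import Data.List.Relation.Unary.All as All using (All)
  open import Relation.Binary.PropositionalEquality

  sum-map-++ : ∀ {A : Set} (f : A → ℕ) xs ys → sum (map f (xs ++ ys)) ≡ sum (map f xs) + sum (map f ys)
  sum-map-++ f xs ys = trans (cong sum (map-++ f xs ys)) (sum-++ (map f xs) (map f ys))

  sum-map-concatMap : ∀ {A B : Set} (f : B → ℕ) (g : A → List B) xs →
    sum (map f (concatMap g xs)) ≡ sum (map (λ x → sum (map f (g x))) xs)
  sum-map-concatMap f g []       = refl
  sum-map-concatMap f g (x ∷ xs) =
    trans (sum-map-++ f (g x) (concatMap g xs)) (cong (sum (map f (g x)) +_) (sum-map-concatMap f g xs))

  sum-map-cong-All : ∀ {A : Set} {P : A → Set} {f g : A → ℕ} {xs} →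
    All P xs → (∀ {x} → P x → f x ≡ g x) → sum (map f xs) ≡ sum (map g xs)
  sum-map-cong-All ps f≡g = cong sum (map-cong-local (All.map f≡g ps))

  sum-map-zero : ∀ {A : Set} (xs : List A) → sum (map (λ _ → 0) xs) ≡ 0
  sum-map-zero []       = refl
  sum-map-zero (x ∷ xs) = sum-map-zero xs

  sum-map-if : ∀ {A : Set} (c : Bool) (f : A → ℕ) xs →
    sum (map (λ x → if c then f x else 0) xs) ≡ (if c then sum (map f xs) else 0)
  sum-map-if true  f xs = refl
  sum-map-if false f xs = sum-map-zero xs

  sum-map-+ : ∀ {A : Set} (f g : A → ℕ) xs → sum (map (λ x → f x + g x) xs) ≡ sum (map f xs) + sum (map g xs)
  sum-map-+ f g []       = refl
  sum-map-+ f g (x ∷ xs) = trans (cong (f x + g x +_) (sum-map-+ f g xs)) (interchange (f x) (g x) _ _)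

  length-filter-indicator : ∀ {A : Set} {P : A → Set} (P? : Decidable P) (f : A → ℕ) →
    (∀ x → (P x → f x ≡ 1) × (¬ P x → f x ≡ 0)) → ∀ xs → length (filter P? xs) ≡ sum (map f xs)
  length-filter-indicator P? f f-ind []       = refl
  length-filter-indicator P? f f-ind (x ∷ xs) with P? x
  ... | yes px = cong₂ _+_ (sym (proj₁ (f-ind x) px)) (length-filter-indicator P? f f-ind xs)
  ... | no ¬px = trans (length-filter-indicator P? f f-ind xs) (cong (_+ sum (map f xs)) (sym (proj₂ (f-ind x) ¬px)))

  sum-map-swap : ∀ {A B : Set} (h : A → B → ℕ) (xs : List A) (ys : List B) →
    sum (map (λ y → sum (map (λ x → h x y) xs)) ys) ≡ sum (map (λ x → sum (map (h x) ys)) xs)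
  sum-map-swap h []       ys = sum-map-zero ys
  sum-map-swap h (x ∷ xs) ys =
    trans (sum-map-+ (h x) (λ y → sum (map (λ x → h x y) xs)) ys) (cong (sum (map (h x) ys) +_) (sum-map-swap h xs ys))

-- The peak word of a permutation a₁…aₙ is the list of bits e₂ … eₙ,
-- where eᵢ records whether i is a peak (so eₙ = false).  A *pattern* σ stands for the
-- infinite word σ false false …; it matches e when e is σ padded with falses.
module PeakWords where
  open import Data.Nat as ℕ using (zero; suc; _≤_; z≤n; s≤s; _+_)
  import Data.Nat.Properties as ℕP
  open import Data.Bool using (Bool; true; false; _∧_; _∨_; not; if_then_else_)
  open import Data.Bool.Properties using (∧-zeroʳ; ∨-zeroʳ)
  open import Data.Nat.ListAction using (sum)
  open import Data.List using (_∷_; map; drop; _++_; _∷ʳ_; concatMap)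
  import Data.List.Properties as LP
  open import Data.List.Relation.Unary.All as All using (All; []; _∷_)
  import Data.List.Relation.Unary.All.Properties as AllP
  open import Data.Product using (Σ; _,_; _×_)
  open import Data.Sum using (_⊎_; inj₁; inj₂)
  open import Relation.Binary.PropositionalEquality
  open Sums

  sameBit : Bool → Bool → Bool
  sameBit false b = not b
  sameBit true  b = b

  allFalse : List Bool → Bool
  allFalse []      = true
  allFalse (b ∷ e) = not b ∧ allFalse e

  matches : List Bool → List Bool → Bool
  matches []      e       = allFalse e
  matches (s ∷ σ) []      = false
  matches (s ∷ σ) (b ∷ e) = sameBit s b ∧ matches σ e

  hits : List Bool → List Bool → ℕ
  hits σ e = if matches σ e then 1 else 0

  hitsIn : List (List Bool) → List Bool → ℕ
  hitsIn τs e = sum (map (λ τ → hits τ e) τs)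

  -- head and tail of the padded word σ false false …
  headBit : List Bool → Bool
  headBit []      = false
  headBit (s ∷ _) = s

  tailBits : List Bool → List Bool
  tailBits []      = []
  tailBits (_ ∷ σ) = σ

  hits-∷ : ∀ σ b e → hits σ (b ∷ e) ≡ (if sameBit (headBit σ) b then hits (tailBits σ) e else 0)
  hits-∷ []      false e = refl
  hits-∷ []      true  e = refl
  hits-∷ (s ∷ σ) b     e with sameBit s b
  ... | true  = refl
  ... | false = refl

  -- A pattern is normal if it is empty or ends with a peak; every peak set has a normal pattern.
  Normal : List Bool → Set
  Normal σ = σ ≡ [] ⊎ Σ (List Bool) (λ ρ → σ ≡ ρ ∷ʳ true)

  adjacentPeaks : List Bool → Bool
  adjacentPeaks (a ∷ b ∷ σ) = (a ∧ b) ∨ adjacentPeaks (b ∷ σ)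
  adjacentPeaks _           = false

  range : ℕ → ℕ → List ℕ
  range k zero    = []
  range k (suc n) = k ∷ range (suc k) n

  range-++ : ∀ k a b → range k (a + b) ≡ range k a ++ range (k + a) b
  range-++ k zero    b = cong (λ j → range j b) (sym (ℕP.+-identityʳ k))
  range-++ k (suc a) b = cong (k ∷_) (trans (range-++ (suc k) a b) (cong (λ j → range (suc k) a ++ range j b) (sym (ℕP.+-suc k a))))

  range-bounds : ∀ k n → All (λ i → k ≤ i × i < k + n) (range k n)
  range-bounds k zero    = []
  range-bounds k (suc n) = (ℕP.≤-refl , k<k+1+n) ∷ All.map weaken (range-bounds (suc k) n)
    where
    k<k+1+n : k < k + suc n
    k<k+1+n = subst (k <_) (sym (ℕP.+-suc k n)) (s≤s (ℕP.m≤m+n k n))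
    weaken : ∀ {i} → suc k ≤ i × i < suc k + n → k ≤ i × i < k + suc n
    weaken {i} (k<i , i<) = ℕP.<⇒≤ k<i , subst (i <_) (sym (ℕP.+-suc k n)) i<

  -- Peak word after inserting a new largest letter between letters i and i+1 (1 ≤ i):
  -- the new letter becomes a peak at position i+1 and destroys the peaks next to it.
  insertAt : ℕ → List Bool → List Bool
  insertAt zero                e       = []
  insertAt (suc zero)          e       = true ∷ false ∷ drop 1 e
  insertAt (suc (suc zero))    e       = false ∷ true ∷ false ∷ drop 2 e
  insertAt (suc (suc (suc i))) []      = []
  insertAt (suc (suc (suc i))) (b ∷ e) = b ∷ insertAt (suc (suc i)) e

  insertionWords : List Bool → List (List Bool)
  insertionWords e = (false ∷ e) ∷ (map (λ i → insertAt i e) (range 1 (length e)) ++ (e ∷ʳ false) ∷ [])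

  -- The patterns τ such that hits σ (insertAt i e) is the number of τ matching e.
  -- For i ≤ 2 the bits overwritten by the insertion become arbitrary.
  preimages : ℕ → List Bool → List (List Bool)
  preimages zero                σ = []
  preimages (suc zero)          σ =
    if headBit σ ∧ not (headBit (tailBits σ)) then (true ∷ ρ) ∷ (false ∷ ρ) ∷ [] else []
    where ρ = tailBits (tailBits σ)
  preimages (suc (suc zero))    σ =
    if not (headBit σ) ∧ (headBit (tailBits σ) ∧ not (headBit (tailBits (tailBits σ))))
    then (true ∷ true ∷ ρ) ∷ (true ∷ false ∷ ρ) ∷ (false ∷ true ∷ ρ) ∷ (false ∷ false ∷ ρ) ∷ [] else []
    where ρ = tailBits (tailBits (tailBits σ))
  preimages (suc (suc (suc i))) σ = map (headBit σ ∷_) (preimages (suc (suc i)) (tailBits σ))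

  interiorPreimages : List Bool → List (List Bool)
  interiorPreimages σ = concatMap (λ i → preimages i σ) (range 1 (length σ))

  frontPreimages : List Bool → List (List Bool)
  frontPreimages []          = [] ∷ []
  frontPreimages (false ∷ σ) = σ ∷ []
  frontPreimages (true ∷ σ)  = []

  hits-false∷ : ∀ σ e → hits σ (false ∷ e) ≡ hitsIn (frontPreimages σ) e
  hits-false∷ []          e = sym (ℕP.+-identityʳ _)
  hits-false∷ (false ∷ σ) e = sym (ℕP.+-identityʳ _)
  hits-false∷ (true ∷ σ)  e = refl

  hits-insertAt-1 : ∀ σ b e → hits σ (true ∷ false ∷ e) ≡ hitsIn (preimages 1 σ) (b ∷ e)
  hits-insertAt-1 σ b e
    rewrite hits-∷ σ true (false ∷ e) | hits-∷ (tailBits σ) false e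
    with headBit σ | headBit (tailBits σ)
  ... | false | _    = refl
  ... | true  | true = refl
  ... | true  | false with b | matches (tailBits (tailBits σ)) e
  ...   | true  | true  = refl
  ...   | true  | false = refl
  ...   | false | true  = refl
  ...   | false | false = refl

  hits-insertAt-2 : ∀ σ b c e → hits σ (false ∷ true ∷ false ∷ e) ≡ hitsIn (preimages 2 σ) (b ∷ c ∷ e)
  hits-insertAt-2 σ b c e
    rewrite hits-∷ σ false (true ∷ false ∷ e) | hits-∷ (tailBits σ) true (false ∷ e)
          | hits-∷ (tailBits (tailBits σ)) false e
    with headBit σ | headBit (tailBits σ) | headBit (tailBits (tailBits σ))
  ... | true  | _     | _    = refl
  ... | false | false | _    = refl
  ... | false | true  | true = refl
  ... | false | true  | false with b | c | matches (tailBits (tailBits (tailBits σ))) e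
  ...   | true  | true  | true  = refl
  ...   | true  | true  | false = refl
  ...   | true  | false | true  = refl
  ...   | true  | false | false = refl
  ...   | false | true  | true  = refl
  ...   | false | true  | false = refl
  ...   | false | false | true  = refl
  ...   | false | false | false = refl

  -- Interior insertion: further right, the first bit of the pattern is compared unchanged.
  hits-insertAt : ∀ i σ e → 1 ≤ i → i ≤ length e → hits σ (insertAt i e) ≡ hitsIn (preimages i σ) e
  hits-insertAt (suc zero)          σ (b ∷ e)     _ _ = hits-insertAt-1 σ b e
  hits-insertAt (suc (suc zero))    σ (b ∷ c ∷ e) _ _ = hits-insertAt-2 σ b c e
  hits-insertAt (suc (suc zero))    σ (b ∷ [])    _ (s≤s ())
  hits-insertAt (suc (suc (suc i))) σ (b ∷ e)     _ (s≤s i<∣e∣) = begin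
      hits σ (b ∷ insertAt (suc (suc i)) e)
    ≡⟨ hits-∷ σ b _ ⟩
      (if sameBit (headBit σ) b then hits (tailBits σ) (insertAt (suc (suc i)) e) else 0)
    ≡⟨ cong (λ z → if sameBit (headBit σ) b then z else 0) (hits-insertAt (suc (suc i)) (tailBits σ) e (s≤s z≤n) i<∣e∣) ⟩
      (if sameBit (headBit σ) b then hitsIn τs e else 0)
    ≡⟨ sym (sum-map-if (sameBit (headBit σ) b) (λ τ → hits τ e) τs) ⟩
      sum (map (λ τ → if sameBit (headBit σ) b then hits τ e else 0) τs)
    ≡⟨ cong sum (LP.map-cong (λ τ → sym (hits-∷ (headBit σ ∷ τ) b e)) τs) ⟩
      sum (map (λ τ → hits (headBit σ ∷ τ) (b ∷ e)) τs)
    ≡⟨ cong sum (LP.map-∘ τs) ⟩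
      hitsIn (preimages (suc (suc (suc i))) σ) (b ∷ e)
    ∎
    where
    open ≡-Reasoning
    τs = preimages (suc (suc i)) (tailBits σ)

  tailBits-shorter : ∀ {i} σ → length σ < suc (suc i) → length (tailBits σ) < suc i
  tailBits-shorter []      _        = s≤s z≤n
  tailBits-shorter (_ ∷ σ) (s≤s lt) = lt

  -- Inserting beyond the end of the pattern produces a peak the pattern does not have.
  hits-insertAt-beyond : ∀ i σ e → 1 ≤ i → i ≤ length e → length σ < i → hits σ (insertAt i e) ≡ 0
  hits-insertAt-beyond (suc zero)          []          e _ _ _ = refl
  hits-insertAt-beyond (suc zero)          (_ ∷ _)     e _ _ (s≤s ())
  hits-insertAt-beyond (suc (suc zero))    []          e _ _ _ = refl
  hits-insertAt-beyond (suc (suc zero))    (false ∷ []) e _ _ _ = refl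
  hits-insertAt-beyond (suc (suc zero))    (true ∷ [])  e _ _ _ = refl
  hits-insertAt-beyond (suc (suc zero))    (_ ∷ _ ∷ _) e _ _ (s≤s (s≤s ()))
  hits-insertAt-beyond (suc (suc (suc i))) σ (b ∷ e) _ (s≤s i<∣e∣) ∣σ∣<i
    rewrite hits-∷ σ b (insertAt (suc (suc i)) e)
          | hits-insertAt-beyond (suc (suc i)) (tailBits σ) e (s≤s z≤n) i<∣e∣ (tailBits-shorter σ ∣σ∣<i)
    with sameBit (headBit σ) b
  ... | true  = refl
  ... | false = refl

  allFalse-∷ʳ : ∀ e → allFalse (e ∷ʳ false) ≡ allFalse e
  allFalse-∷ʳ []      = refl
  allFalse-∷ʳ (b ∷ e) = cong (not b ∧_) (allFalse-∷ʳ e)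

  hits-∷ʳ-false : ∀ σ e → Normal σ → hits σ (e ∷ʳ false) ≡ hits σ e
  hits-∷ʳ-false .[] e (inj₁ refl)       = cong (λ z → if z then 1 else 0) (allFalse-∷ʳ e)
  hits-∷ʳ-false σ  e (inj₂ (ρ , refl)) = cong (λ z → if z then 1 else 0) (matches-∷ʳ ρ e)
    where
    matches-[] : ∀ ρ → matches (ρ ∷ʳ true) [] ≡ false
    matches-[] []      = refl
    matches-[] (_ ∷ _) = refl
    matches-∷ʳ : ∀ ρ e → matches (ρ ∷ʳ true) (e ∷ʳ false) ≡ matches (ρ ∷ʳ true) e
    matches-∷ʳ []      []      = refl
    matches-∷ʳ []      (b ∷ e) = cong (b ∧_) (allFalse-∷ʳ e)
    matches-∷ʳ (r ∷ ρ) []      = trans (cong (sameBit r false ∧_) (matches-[] ρ)) (∧-zeroʳ _)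
    matches-∷ʳ (r ∷ ρ) (b ∷ e) = cong (sameBit r b ∧_) (matches-∷ʳ ρ e)

  -- Counting the insertions of a new largest letter whose peak word matches a normal σ:
  -- the front insertion, the interior ones (only positions up to length σ can match),
  -- and the end insertion, which behaves like e itself.
  hits-insertionWords : ∀ σ e → Normal σ → length σ ≤ length e →
    sum (map (hits σ) (insertionWords e)) ≡ hits σ (false ∷ e) + (hitsIn (interiorPreimages σ) e + hits σ e)
  hits-insertionWords σ e normal ∣σ∣≤∣e∣ = cong (hits σ (false ∷ e) +_) (begin
      sum (map (hits σ) (map (λ i → insertAt i e) (range 1 (length e)) ++ (e ∷ʳ false) ∷ []))
    ≡⟨ sum-map-++ (hits σ) (map (λ i → insertAt i e) (range 1 (length e))) _ ⟩
      sum (map (hits σ) (map (λ i → insertAt i e) (range 1 (length e)))) + (hits σ (e ∷ʳ false) + 0)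
    ≡⟨ cong₂ _+_ (cong sum (sym (LP.map-∘ (range 1 (length e))))) (trans (ℕP.+-identityʳ _) (hits-∷ʳ-false σ e normal)) ⟩
      sum (map interior (range 1 (length e))) + hits σ e
    ≡⟨ cong (λ is → sum (map interior is) + hits σ e) split ⟩
      sum (map interior (range 1 (length σ) ++ range (suc (length σ)) rest)) + hits σ e
    ≡⟨ cong (_+ hits σ e) (sum-map-++ interior (range 1 (length σ)) _) ⟩
      (sum (map interior (range 1 (length σ))) + sum (map interior (range (suc (length σ)) rest))) + hits σ e
    ≡⟨ cong₂ (λ u v → (u + v) + hits σ e)
         (sum-map-cong-All (range-bounds 1 (length σ)) within)
         (trans (sum-map-cong-All (range-bounds _ rest) beyond) (sum-map-zero (range (suc (length σ)) rest))) ⟩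
      (sum (map (λ i → hitsIn (preimages i σ) e) (range 1 (length σ))) + 0) + hits σ e
    ≡⟨ cong (_+ hits σ e) (trans (ℕP.+-identityʳ _) (sym (sum-map-concatMap (λ τ → hits τ e) (λ i → preimages i σ) (range 1 (length σ))))) ⟩
      hitsIn (interiorPreimages σ) e + hits σ e
    ∎)
    where
    open ≡-Reasoning
    interior : ℕ → ℕ
    interior i = hits σ (insertAt i e)
    rest = length e ℕ.∸ length σ
    split : range 1 (length e) ≡ range 1 (length σ) ++ range (suc (length σ)) rest
    split = trans (cong (range 1) (sym (ℕP.m+[n∸m]≡n ∣σ∣≤∣e∣))) (range-++ 1 (length σ) rest)
    within : ∀ {i} → 1 ≤ i × i < suc (length σ) → interior i ≡ hitsIn (preimages i σ) e
    within {i} (1≤i , i≤∣σ∣) = hits-insertAt i σ e 1≤i (ℕP.≤-trans (ℕP.≤-pred i≤∣σ∣) ∣σ∣≤∣e∣)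
    beyond : ∀ {i} → suc (length σ) ≤ i × i < suc (length σ) + rest → interior i ≡ 0
    beyond {i} (∣σ∣<i , i≤∣e∣) = hits-insertAt-beyond i σ e (ℕP.≤-trans (s≤s z≤n) ∣σ∣<i)
      (ℕP.≤-pred (subst (i <_) (cong suc (ℕP.m+[n∸m]≡n ∣σ∣≤∣e∣)) i≤∣e∣)) ∣σ∣<i

  adjacentPeaks-tail : ∀ x y e → adjacentPeaks (x ∷ y ∷ e) ≡ false → adjacentPeaks (y ∷ e) ≡ false
  adjacentPeaks-tail true  true  e ()
  adjacentPeaks-tail true  false e no-adj = no-adj
  adjacentPeaks-tail false y     e no-adj = no-adj

  matches-adjacentPeaks : ∀ τ e → adjacentPeaks τ ≡ true → adjacentPeaks e ≡ false → matches τ e ≡ false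
  matches-adjacentPeaks (a ∷ b ∷ τ) []          adj no-adj = refl
  matches-adjacentPeaks (a ∷ b ∷ τ) (x ∷ [])    adj no-adj = ∧-zeroʳ (sameBit a x)
  matches-adjacentPeaks (true ∷ true ∷ τ)  (true ∷ true ∷ e)  adj ()
  matches-adjacentPeaks (true ∷ true ∷ τ)  (true ∷ false ∷ e) adj no-adj = refl
  matches-adjacentPeaks (true ∷ true ∷ τ)  (false ∷ y ∷ e)    adj no-adj = refl
  matches-adjacentPeaks (true ∷ false ∷ τ) (x ∷ y ∷ e)        adj no-adj =
    trans (cong (sameBit true x ∧_) (matches-adjacentPeaks (false ∷ τ) (y ∷ e) adj (adjacentPeaks-tail x y e no-adj)))
          (∧-zeroʳ _)
  matches-adjacentPeaks (false ∷ b ∷ τ)    (x ∷ y ∷ e)        adj no-adj =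
    trans (cong (sameBit false x ∧_) (matches-adjacentPeaks (b ∷ τ) (y ∷ e) adj (adjacentPeaks-tail x y e no-adj)))
          (∧-zeroʳ _)

  adjacentPeaks-TT : ∀ ρ → adjacentPeaks (ρ ++ true ∷ true ∷ []) ≡ true
  adjacentPeaks-TT []            = refl
  adjacentPeaks-TT (true ∷ [])   = refl
  adjacentPeaks-TT (false ∷ [])  = refl
  adjacentPeaks-TT (a ∷ b ∷ ρ)   = trans (cong ((a ∧ b) ∨_) (adjacentPeaks-TT (b ∷ ρ))) (∨-zeroʳ (a ∧ b))

  hits-pattern-∷ʳ-false : ∀ ρ e → length ρ < length e → hits (ρ ∷ʳ false) e ≡ hits ρ e
  hits-pattern-∷ʳ-false ρ e ∣ρ∣<∣e∣ = cong (λ z → if z then 1 else 0) (matches-∷ʳ ρ e ∣ρ∣<∣e∣)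
    where
    matches-∷ʳ : ∀ ρ e → length ρ < length e → matches (ρ ∷ʳ false) e ≡ matches ρ e
    matches-∷ʳ []      (b ∷ e) _         = refl
    matches-∷ʳ (r ∷ ρ) (b ∷ e) (s≤s lt) = cong (sameBit r b ∧_) (matches-∷ʳ ρ e lt)

  preimages-length : ∀ i σ → 1 ≤ i → i < length σ → All (λ τ → suc (length τ) ≡ length σ) (preimages i σ)
  preimages-length (suc zero) (a ∷ b ∷ σ) _ _ with a ∧ not b
  ... | true  = refl ∷ refl ∷ []
  ... | false = []
  preimages-length (suc (suc zero)) (a ∷ b ∷ c ∷ σ) _ _ with not a ∧ (b ∧ not c)
  ... | true  = refl ∷ refl ∷ refl ∷ refl ∷ []
  ... | false = []
  preimages-length (suc (suc (suc i))) (a ∷ σ) _ (s≤s i<∣σ∣) =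
    AllP.map⁺ (All.map (cong suc) (preimages-length (suc (suc i)) σ (s≤s z≤n) i<∣σ∣))
  preimages-length (suc zero)       (a ∷ [])     _ (s≤s ())
  preimages-length (suc (suc zero)) (a ∷ [])     _ (s≤s ())
  preimages-length (suc (suc zero)) (a ∷ b ∷ []) _ (s≤s (s≤s ()))

  -- ρ followed by a non-peak and a peak: the general shape of a normal pattern of length ≥ 2
  -- without adjacent peaks
  _⁺ : List Bool → List Bool
  ρ ⁺ = ρ ++ false ∷ true ∷ []

  length-⁺ : ∀ ρ → length (ρ ⁺) ≡ suc (suc (length ρ))
  length-⁺ ρ = LP.length-++-comm ρ (false ∷ true ∷ [])

  -- Inserting right before the last peak of ρ ⁺: the two bits it overwrites are arbitrary,
  -- so one of the preimages is ρ ⁺ itself.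
  preimages-last : ∀ ρ → preimages (length (ρ ⁺)) (ρ ⁺) ≡
    (ρ ++ true ∷ true ∷ []) ∷ (ρ ++ true ∷ false ∷ []) ∷ ρ ⁺ ∷ (ρ ++ false ∷ false ∷ []) ∷ []
  preimages-last []      = refl
  preimages-last (r ∷ ρ) rewrite length-⁺ ρ =
    cong (map (r ∷_)) (trans (cong (λ i → preimages i (ρ ⁺)) (sym (length-⁺ ρ))) (preimages-last ρ))

  interiorPreimages-split : ∀ σ k → length σ ≡ suc k →
    interiorPreimages σ ≡ concatMap (λ i → preimages i σ) (range 1 k) ++ (preimages (length σ) σ ++ [])
  interiorPreimages-split σ k ∣σ∣≡1+k rewrite ∣σ∣≡1+k =
    trans (cong (concatMap (λ i → preimages i σ)) (trans (cong (range 1) (ℕP.+-comm 1 k)) (range-++ 1 k 1)))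
          (LP.concatMap-++ (λ i → preimages i σ) (range 1 k) _)

-- Permutations of {1,…,n+1} arise from those of {1,…,n} by inserting n+1 (this is how
-- perms is built).
module InsertingTheLargestLetter where
  open import Data.Nat as ℕ using (zero; suc; _≤_; z≤n; s≤s; _+_; _<?_)
  import Data.Nat.Properties as ℕP
  open import Data.Bool using (Bool; true; false; _∧_; _∨_; if_then_else_)
  open import Data.Bool.Properties using (∧-zeroʳ)
  open import Data.Nat.ListAction using (sum)
  open import Data.List using (_∷_; map; _++_; _∷ʳ_; concatMap)
  import Data.List.Properties as LP
  open import Data.List.Relation.Unary.All as All using (All; []; _∷_)
  import Data.List.Relation.Unary.All.Properties as AllP
  open import Data.Product using (_,_; _×_)
  open import Data.Unit using (⊤)
  open import Data.Empty using (⊥-elim)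
  open import Relation.Nullary using (Dec; ¬_)
  open import Relation.Nullary.Decidable using (⌊_⌋; yes; no; dec-true; dec-false; isYes≗does)
  open import Relation.Binary.PropositionalEquality
  open Sums
  open PeakWords

  peakBit : ℕ → ℕ → ℕ → Bool
  peakBit a b c = ⌊ a <? b ⌋ ∧ ⌊ c <? b ⌋

  peakBits : List ℕ → List Bool
  peakBits (a ∷ b ∷ c ∷ r) = peakBit a b c ∷ peakBits (b ∷ c ∷ r)
  peakBits (a ∷ b ∷ [])    = false ∷ []
  peakBits _               = []

  length-peakBits : ∀ w → length (peakBits w) ≡ length w ℕ.∸ 1
  length-peakBits []              = refl
  length-peakBits (a ∷ [])        = refl
  length-peakBits (a ∷ b ∷ [])    = refl
  length-peakBits (a ∷ b ∷ c ∷ r) = cong suc (length-peakBits (b ∷ c ∷ r))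

  peakBits-noAdjacent : ∀ w → adjacentPeaks (peakBits w) ≡ false
  peakBits-noAdjacent []                  = refl
  peakBits-noAdjacent (a ∷ [])            = refl
  peakBits-noAdjacent (a ∷ b ∷ [])        = refl
  peakBits-noAdjacent (a ∷ b ∷ c ∷ [])    = cong (_∨ false) (∧-zeroʳ (peakBit a b c))
  peakBits-noAdjacent (a ∷ b ∷ c ∷ d ∷ r) = cong₂ _∨_ (not-both a b c d) (peakBits-noAdjacent (b ∷ c ∷ d ∷ r))
    where
    not-both : ∀ a b c d → peakBit a b c ∧ peakBit b c d ≡ false
    not-both a b c d with a <? b | c <? b | b <? c
    ... | no _  | _     | _     = refl
    ... | yes _ | no _  | _     = refl
    ... | yes _ | yes _ | no _  = refl
    ... | yes _ | yes c<b | yes b<c = ⊥-elim (ℕP.<-asym c<b b<c)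

  ⌊⌋-true : ∀ {A : Set} (a? : Dec A) → A → ⌊ a? ⌋ ≡ true
  ⌊⌋-true a? a = trans (isYes≗does a?) (dec-true a? a)

  ⌊⌋-false : ∀ {A : Set} (a? : Dec A) → ¬ A → ⌊ a? ⌋ ≡ false
  ⌊⌋-false a? ¬a = trans (isYes≗does a?) (dec-false a? ¬a)

  peakBit-before : ∀ {x a b} → a < x → peakBit x a b ≡ false
  peakBit-before {x} {a} {b} a<x = cong (_∧ ⌊ b <? a ⌋) (⌊⌋-false (x <? a) (ℕP.<-asym a<x))

  peakBit-at : ∀ {x a b} → a < x → b < x → peakBit a x b ≡ true
  peakBit-at {x} {a} {b} a<x b<x = cong₂ _∧_ (⌊⌋-true (a <? x) a<x) (⌊⌋-true (b <? x) b<x)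

  peakBit-after : ∀ {x a b} → b < x → peakBit a b x ≡ false
  peakBit-after {x} {a} {b} b<x =
    trans (cong (⌊ a <? b ⌋ ∧_) (⌊⌋-false (x <? b) (ℕP.<-asym b<x))) (∧-zeroʳ _)

  EndsFalse : List Bool → Set
  EndsFalse []          = ⊤
  EndsFalse (b ∷ [])    = b ≡ false
  EndsFalse (b ∷ c ∷ e) = EndsFalse (c ∷ e)

  peakBits-endsFalse : ∀ w → EndsFalse (peakBits w)
  peakBits-endsFalse []                  = _
  peakBits-endsFalse (a ∷ [])            = _
  peakBits-endsFalse (a ∷ b ∷ [])        = refl
  peakBits-endsFalse (a ∷ b ∷ c ∷ [])    = refl
  peakBits-endsFalse (a ∷ b ∷ c ∷ d ∷ r) = peakBits-endsFalse (b ∷ c ∷ d ∷ r)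

  -- insertionWords (b ∷ e) in terms of insertionWords e: prepend b, except that the
  -- first two interior insertions overwrite it.
  prependInsertions : Bool → List (List Bool) → List (List Bool)
  prependInsertions b (u₀ ∷ u₁ ∷ us) = (true ∷ u₀) ∷ (false ∷ u₁) ∷ map (b ∷_) us
  prependInsertions b _              = []

  insertionWords-∷ : ∀ b e → EndsFalse (b ∷ e) →
    insertionWords (b ∷ e) ≡ (false ∷ b ∷ e) ∷ prependInsertions b (insertionWords e)
  insertionWords-∷ .false []      refl = refl
  insertionWords-∷ b      (c ∷ e) _    =
    cong (λ us → (false ∷ b ∷ c ∷ e) ∷ (true ∷ false ∷ c ∷ e) ∷ (false ∷ true ∷ false ∷ e) ∷ us)
      (trans (cong (_++ (b ∷ c ∷ e ∷ʳ false) ∷ []) (shift 0 (length e)))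
             (sym (LP.map-++ (b ∷_) (map (λ i → insertAt i (c ∷ e)) (range 2 (length e))) _)))
    where
    shift : ∀ k m → map (λ i → insertAt i (b ∷ c ∷ e)) (range (3 + k) m)
                  ≡ map (b ∷_) (map (λ i → insertAt i (c ∷ e)) (range (2 + k) m))
    shift k zero    = refl
    shift k (suc m) = cong (_ ∷_) (shift (suc k) m)

  peakBits-insertions : ∀ x a w → All (_< x) (a ∷ w) →
    map peakBits (insertions x (a ∷ w)) ≡ insertionWords (peakBits (a ∷ w))
  peakBits-insertions x a []      _ = refl
  peakBits-insertions x a (b ∷ []) (a<x ∷ b<x ∷ [])
    rewrite peakBit-before {x} {a} {b} a<x | peakBit-at {x} {a} {b} a<x b<x | peakBit-after {x} {a} {b} b<x = refl
  peakBits-insertions x a (b ∷ c ∷ r) (a<x ∷ bcr<x@(b<x ∷ _)) = begin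
      peakBits (x ∷ a ∷ b ∷ c ∷ r) ∷ peakBits (a ∷ x ∷ b ∷ c ∷ r) ∷ peakBits (a ∷ b ∷ x ∷ c ∷ r) ∷ later
    ≡⟨ cong₃ (λ u v t → (u ∷ e) ∷ (v ∷ e₁) ∷ (t ∷ e₂) ∷ later)
             (peakBit-before {x} {a} {b} a<x) (peakBit-at {x} {a} {b} a<x b<x) (peakBit-after {x} {a} {b} b<x) ⟩
      (false ∷ e) ∷ (true ∷ e₁) ∷ (false ∷ e₂) ∷ later
    ≡⟨ cong (λ us → (false ∷ e) ∷ (true ∷ e₁) ∷ (false ∷ e₂) ∷ us) (map-deep (insertions x r)) ⟩
      (false ∷ e) ∷ prependInsertions (peakBit a b c) (map peakBits (insertions x (b ∷ c ∷ r)))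
    ≡⟨ cong (λ us → (false ∷ e) ∷ prependInsertions (peakBit a b c) us) (peakBits-insertions x b (c ∷ r) bcr<x) ⟩
      (false ∷ e) ∷ prependInsertions (peakBit a b c) (insertionWords (peakBits (b ∷ c ∷ r)))
    ≡⟨ sym (insertionWords-∷ (peakBit a b c) (peakBits (b ∷ c ∷ r)) (peakBits-endsFalse (a ∷ b ∷ c ∷ r))) ⟩
      insertionWords e
    ∎
    where
    open ≡-Reasoning
    cong₃ : ∀ {A : Set} (f : Bool → Bool → Bool → A) {u u′ v v′ t t′} → u ≡ u′ → v ≡ v′ → t ≡ t′ → f u v t ≡ f u′ v′ t′
    cong₃ f refl refl refl = refl
    e e₁ e₂ : List Bool
    e  = peakBits (a ∷ b ∷ c ∷ r)
    e₁ = peakBits (x ∷ b ∷ c ∷ r)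
    e₂ = peakBits (b ∷ x ∷ c ∷ r)
    deep : List (List ℕ) → List (List ℕ)
    deep us = map (a ∷_) (map (b ∷_) (map (c ∷_) us))
    -- insertions further right keep the first bit peakBit a b c
    map-deep : ∀ us → map peakBits (deep us) ≡ map (peakBit a b c ∷_) (map peakBits (map (b ∷_) (map (c ∷_) us)))
    map-deep []       = refl
    map-deep (u ∷ us) = cong (_ ∷_) (map-deep us)
    later : List (List Bool)
    later = map peakBits (deep (insertions x r))

  -- What we use about w ∈ perms n: it has length n and its letters are at most n.
  Shape : ℕ → List ℕ → Set
  Shape n w = length w ≡ n × All (_< suc n) w

  insertions-shape : ∀ x w → All (_< x) w → All (λ v → length v ≡ suc (length w) × All (_< suc x) v) (insertions x w)
  insertions-shape x []      []           = (refl , (ℕP.≤-refl ∷ [])) ∷ []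
  insertions-shape x (a ∷ w) (a<x ∷ w<x) =
    (refl , (ℕP.≤-refl ∷ ℕP.m<n⇒m<1+n a<x ∷ All.map ℕP.m<n⇒m<1+n w<x))
    ∷ AllP.map⁺ (All.map (λ (∣v∣≡ , v<) → cong suc ∣v∣≡ , (ℕP.m<n⇒m<1+n a<x ∷ v<)) (insertions-shape x w w<x))

  perms-shape : ∀ n → All (Shape n) (perms n)
  perms-shape zero    = (refl , []) ∷ []
  perms-shape (suc n) = AllP.concat⁺ (AllP.map⁺ (All.map insert (perms-shape n)))
    where
    insert : ∀ {w} → Shape n w → All (Shape (suc n)) (insertions (suc n) w)
    insert {w} (∣w∣≡n , w<1+n) = All.map (λ (∣v∣≡ , v<) → trans ∣v∣≡ (cong suc ∣w∣≡n) , v<) (insertions-shape (suc n) w w<1+n)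

  count : List Bool → ℕ → ℕ
  count σ n = sum (map (λ w → hits σ (peakBits w)) (perms n))

  countIn : List (List Bool) → ℕ → ℕ
  countIn τs n = sum (map (λ τ → count τ n) τs)

  countIn-++ : ∀ τs υs n → countIn (τs ++ υs) n ≡ countIn τs n + countIn υs n
  countIn-++ τs υs n = sum-map-++ (λ τ → count τ n) τs υs

  count-adjacentPeaks : ∀ τ n → adjacentPeaks τ ≡ true → count τ n ≡ 0
  count-adjacentPeaks τ n adj =
    trans (cong sum (LP.map-cong never (perms n))) (sum-map-zero (perms n))
    where
    never : ∀ w → hits τ (peakBits w) ≡ 0
    never w = cong (λ z → if z then 1 else 0) (matches-adjacentPeaks τ (peakBits w) adj (peakBits-noAdjacent w))

  count-∷ʳ-false : ∀ ρ n → suc (suc (length ρ)) ≤ n → count (ρ ∷ʳ false) n ≡ count ρ n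
  count-∷ʳ-false ρ n 2+∣ρ∣≤n = sum-map-cong-All (perms-shape n) λ {w} (∣w∣≡n , _) →
    hits-pattern-∷ʳ-false ρ (peakBits w)
      (subst (length ρ <_) (sym (trans (length-peakBits w) (cong (ℕ._∸ 1) ∣w∣≡n))) (ℕP.∸-monoˡ-≤ 1 2+∣ρ∣≤n))

  hits-insertions : ∀ σ n w → Normal σ → suc (length σ) ≤ n → Shape n w →
    sum (map (λ v → hits σ (peakBits v)) (insertions (suc n) w))
      ≡ hitsIn (frontPreimages σ) (peakBits w) + (hitsIn (interiorPreimages σ) (peakBits w) + hits σ (peakBits w))
  hits-insertions σ n [] normal 1+∣σ∣≤n (∣w∣≡n , _) =
    ⊥-elim (ℕP.<-irrefl refl (ℕP.<-≤-trans (s≤s z≤n) (subst (suc (length σ) ≤_) (sym ∣w∣≡n) 1+∣σ∣≤n)))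
  hits-insertions σ n (a ∷ w) normal 1+∣σ∣≤n (∣w∣≡n , w<1+n) = begin
      sum (map (λ v → hits σ (peakBits v)) (insertions (suc n) (a ∷ w)))
    ≡⟨ cong sum (LP.map-∘ (insertions (suc n) (a ∷ w))) ⟩
      sum (map (hits σ) (map peakBits (insertions (suc n) (a ∷ w))))
    ≡⟨ cong (λ es → sum (map (hits σ) es)) (peakBits-insertions (suc n) a w w<1+n) ⟩
      sum (map (hits σ) (insertionWords e))
    ≡⟨ hits-insertionWords σ e normal ∣σ∣≤∣e∣ ⟩
      hits σ (false ∷ e) + (hitsIn (interiorPreimages σ) e + hits σ e)
    ≡⟨ cong (_+ (hitsIn (interiorPreimages σ) e + hits σ e)) (hits-false∷ σ e) ⟩
      hitsIn (frontPreimages σ) e + (hitsIn (interiorPreimages σ) e + hits σ e)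
    ∎
    where
    open ≡-Reasoning
    e = peakBits (a ∷ w)
    ∣σ∣≤∣e∣ : length σ ≤ length e
    ∣σ∣≤∣e∣ = subst (length σ ≤_) (sym (trans (length-peakBits (a ∷ w)) (cong (ℕ._∸ 1) ∣w∣≡n)))
                    (ℕP.∸-monoˡ-≤ 1 1+∣σ∣≤n)

  count-recurrence : ∀ σ n → Normal σ → suc (length σ) ≤ n →
    count σ (suc n) ≡ countIn (frontPreimages σ) n + (countIn (interiorPreimages σ) n + count σ n)
  count-recurrence σ n normal 1+∣σ∣≤n = begin
      sum (map (λ v → hits σ (peakBits v)) (concatMap (insertions (suc n)) (perms n)))
    ≡⟨ sum-map-concatMap (λ v → hits σ (peakBits v)) (insertions (suc n)) (perms n) ⟩
      sum (map (λ w → sum (map (λ v → hits σ (peakBits v)) (insertions (suc n) w))) (perms n))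
    ≡⟨ sum-map-cong-All (perms-shape n) (hits-insertions σ n _ normal 1+∣σ∣≤n) ⟩
      sum (map (λ w → front w + (interior w + hits σ (peakBits w))) (perms n))
    ≡⟨ trans (sum-map-+ front _ (perms n)) (cong (sum (map front (perms n)) +_) (sum-map-+ interior _ (perms n))) ⟩
      sum (map front (perms n)) + (sum (map interior (perms n)) + count σ n)
    ≡⟨ cong₂ (λ u v → u + (v + count σ n)) (swap (frontPreimages σ)) (swap (interiorPreimages σ)) ⟩
      countIn (frontPreimages σ) n + (countIn (interiorPreimages σ) n + count σ n)
    ∎
    where
    open ≡-Reasoning
    front interior : List ℕ → ℕ
    front    w = hitsIn (frontPreimages σ) (peakBits w)
    interior w = hitsIn (interiorPreimages σ) (peakBits w)
    swap : ∀ τs → sum (map (λ w → hitsIn τs (peakBits w)) (perms n)) ≡ countIn τs n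
    swap τs = sum-map-swap (λ τ w → hits τ (peakBits w)) τs (perms n)

-- Every pattern σ has a count that is annihilated from |σ|+1, by
-- induction on |σ|: by count-recurrence, count σ (n+1) − 2·count σ n is a sum of counts of
-- patterns that are shorter, or reduce to shorter ones, or are never realised.
module CountsAreAnnihilated where
  open import Data.Nat using (zero; suc; _≤_; s≤s; _+_)
  import Data.Nat.Properties as ℕP
  open import Data.Nat.Solver using (module +-*-Solver)
  open +-*-Solver using (solve; _:+_; _:=_; con)
  open import Data.Bool using (Bool; true; false)
  open import Data.List using (_∷_; _++_; _∷ʳ_; concatMap; initLast; _∷ʳ′_)
  import Data.List.Properties as LP
  open import Data.List.Relation.Unary.All as All using (All; []; _∷_)
  import Data.List.Relation.Unary.All.Properties as AllP
  open import Data.Product using (_,_)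
  open import Data.Sum using (inj₁; inj₂)
  open import Data.Empty using (⊥-elim)
  open import Relation.Binary.PropositionalEquality
  open NatToRational
  open Annihilation
  open PeakWords
  open InsertingTheLargestLetter

  AnnihilatedCount : List Bool → ℕ → Set
  AnnihilatedCount σ a = Annihilated (λ n → toℚ (count σ n)) a

  ShorterAnnihilated : List Bool → Set
  ShorterAnnihilated σ = ∀ τ → length τ < length σ → AnnihilatedCount τ (suc (length τ))

  annihilated-count-recurrence : ∀ σ a τs →
    (∀ n → a ≤ n → count σ (suc n) ≡ (count σ n + count σ n) + countIn τs n) →
    All (λ τ → AnnihilatedCount τ a) τs → AnnihilatedCount σ a
  annihilated-count-recurrence σ a τs rec τs-ann =
    annihilated-recurrence (count σ) (countIn τs) a rec (annihilated-sum count τs a τs-ann)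

  one-shorter : ∀ σ τ → ShorterAnnihilated σ → suc (length τ) ≡ length σ → AnnihilatedCount τ (suc (length σ))
  one-shorter σ τ ih 1+∣τ∣≡∣σ∣ = annihilated-mono (s≤s (ℕP.<⇒≤ (ℕP.≤-reflexive 1+∣τ∣≡∣σ∣))) (ih τ (ℕP.≤-reflexive 1+∣τ∣≡∣σ∣))

  one-shorter-∷ʳ-false : ∀ σ τ → ShorterAnnihilated σ → suc (length τ) ≡ length σ →
    AnnihilatedCount (τ ∷ʳ false) (suc (length σ))
  one-shorter-∷ʳ-false σ τ ih 1+∣τ∣≡∣σ∣ =
    annihilated-cong (λ n 1+∣σ∣≤n → cong toℚ (sym (count-∷ʳ-false τ n (ℕP.≤-trans (s≤s (ℕP.≤-reflexive 1+∣τ∣≡∣σ∣)) 1+∣σ∣≤n))))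
                     (one-shorter σ τ ih 1+∣τ∣≡∣σ∣)

  length-∷ʳ : ∀ (ρ : List Bool) b → length (ρ ∷ʳ b) ≡ suc (length ρ)
  length-∷ʳ ρ b = LP.length-++-comm ρ (b ∷ [])

  lowerTerms : List Bool → List (List Bool)
  lowerTerms ρ = frontPreimages (ρ ⁺)
              ++ (concatMap (λ i → preimages i (ρ ⁺)) (range 1 (suc (length ρ)))
              ++ ((ρ ++ true ∷ true ∷ []) ∷ (ρ ++ true ∷ false ∷ []) ∷ (ρ ++ false ∷ false ∷ []) ∷ []))

  -- Among the interior preimages of ρ ⁺, the last insertion position contributes ρ ⁺ itself.
  recurrence-⁺ : ∀ ρ n → suc (length (ρ ⁺)) ≤ n →
    count (ρ ⁺) (suc n) ≡ (count (ρ ⁺) n + count (ρ ⁺) n) + countIn (lowerTerms ρ) n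
  recurrence-⁺ ρ n 1+∣σ∣≤n = begin
      count σ (suc n)
    ≡⟨ count-recurrence σ n normal 1+∣σ∣≤n ⟩
      countIn front n + (countIn (interiorPreimages σ) n + count σ n)
    ≡⟨ cong (λ τs → countIn front n + (countIn τs n + count σ n))
            (trans (interiorPreimages-split σ (suc (length ρ)) (length-⁺ ρ)) (cong (λ τs → lower ++ (τs ++ [])) (preimages-last ρ))) ⟩
      countIn front n + (countIn (lower ++ (TT ∷ TF ∷ σ ∷ FF ∷ [] ++ [])) n + count σ n)
    ≡⟨ cong (λ z → countIn front n + (z + count σ n)) (countIn-++ lower _ n) ⟩
      countIn front n + ((countIn lower n + (count TT n + (count TF n + (count σ n + (count FF n + 0))))) + count σ n)
    ≡⟨ regroup (countIn front n) (countIn lower n) (count TT n) (count TF n) (count σ n) (count FF n) ⟩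
      (count σ n + count σ n) + (countIn front n + (countIn lower n + countIn (TT ∷ TF ∷ FF ∷ []) n))
    ≡⟨ cong ((count σ n + count σ n) +_) (trans (cong (countIn front n +_) (sym (countIn-++ lower _ n))) (sym (countIn-++ front _ n))) ⟩
      (count σ n + count σ n) + countIn (lowerTerms ρ) n
    ∎
    where
    open ≡-Reasoning
    σ = ρ ⁺
    front = frontPreimages σ
    lower = concatMap (λ i → preimages i σ) (range 1 (suc (length ρ)))
    TT = ρ ++ true ∷ true ∷ []
    TF = ρ ++ true ∷ false ∷ []
    FF = ρ ++ false ∷ false ∷ []
    normal : Normal σ
    normal = inj₂ (ρ ∷ʳ false , sym (LP.∷ʳ-++ ρ false (true ∷ [])))
    regroup : ∀ f l tt tf s ff → f + ((l + (tt + (tf + (s + (ff + 0))))) + s) ≡ (s + s) + (f + (l + (tt + (tf + (ff + 0)))))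
    regroup = solve 6 (λ f l tt tf s ff → f :+ ((l :+ (tt :+ (tf :+ (s :+ (ff :+ con 0))))) :+ s)
                                        := (s :+ s) :+ (f :+ (l :+ (tt :+ (tf :+ (ff :+ con 0)))))) refl

  frontPreimages-shorter : ∀ ρ → All (λ τ → suc (length τ) ≡ length (ρ ⁺)) (frontPreimages (ρ ⁺))
  frontPreimages-shorter []          = refl ∷ []
  frontPreimages-shorter (false ∷ ρ) = refl ∷ []
  frontPreimages-shorter (true ∷ ρ)  = []

  -- Every term of lowerTerms ρ is one letter shorter than ρ ⁺, never realised (two adjacent
  -- peaks), or a shorter pattern followed by a non-peak.
  annihilated-⁺ : ∀ ρ → ShorterAnnihilated (ρ ⁺) → AnnihilatedCount (ρ ⁺) (suc (length (ρ ⁺)))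
  annihilated-⁺ ρ ih = annihilated-count-recurrence σ a (lowerTerms ρ) (recurrence-⁺ ρ)
    (AllP.++⁺ (All.map (λ {τ} → one-shorter σ τ ih) (frontPreimages-shorter ρ))
    (AllP.++⁺ (All.map (λ {τ} → one-shorter σ τ ih) lower-shorter)
              (TT-never ∷ ∷ʳ-false true TF-≡ ∷ ∷ʳ-false false FF-≡ ∷ [])))
    where
    σ = ρ ⁺
    a = suc (length σ)
    lower-shorter : All (λ τ → suc (length τ) ≡ length σ) (concatMap (λ i → preimages i σ) (range 1 (suc (length ρ))))
    lower-shorter = AllP.concat⁺ (AllP.map⁺ (All.map (λ (1≤i , i<) → preimages-length _ σ 1≤i (subst (_ <_) (sym (length-⁺ ρ)) i<))
                                                     (range-bounds 1 (suc (length ρ)))))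
    TT-never : AnnihilatedCount (ρ ++ true ∷ true ∷ []) a
    TT-never = annihilated-zero a (λ n _ → cong toℚ (count-adjacentPeaks (ρ ++ true ∷ true ∷ []) n (adjacentPeaks-TT ρ)))
    TF-≡ : ρ ++ true ∷ false ∷ [] ≡ (ρ ∷ʳ true) ∷ʳ false
    TF-≡ = sym (LP.∷ʳ-++ ρ true (false ∷ []))
    FF-≡ : ρ ++ false ∷ false ∷ [] ≡ (ρ ∷ʳ false) ∷ʳ false
    FF-≡ = sym (LP.∷ʳ-++ ρ false (false ∷ []))
    ∷ʳ-false : ∀ b {τ} → τ ≡ (ρ ∷ʳ b) ∷ʳ false → AnnihilatedCount τ a
    ∷ʳ-false b refl = one-shorter-∷ʳ-false σ (ρ ∷ʳ b) ih
      (trans (cong suc (length-∷ʳ ρ b)) (sym (length-⁺ ρ)))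

  -- No peaks: count [] (n+1) = 2·count [] n (the new letter goes first or last).
  annihilated-[] : AnnihilatedCount [] 1
  annihilated-[] = annihilated-count-recurrence [] 1 [] (λ n 1≤n → trans (count-recurrence [] n (inj₁ refl) 1≤n) (regroup (count [] n))) []
    where
    regroup : ∀ c → (c + 0) + (0 + c) ≡ (c + c) + 0
    regroup = solve 1 (λ c → (c :+ con 0) :+ (con 0 :+ c) := (c :+ c) :+ con 0) refl

  annihilated-[true] : ShorterAnnihilated (true ∷ []) → AnnihilatedCount (true ∷ []) 2
  annihilated-[true] ih = annihilated-count-recurrence (true ∷ []) 2 ((false ∷ []) ∷ [])
    (λ n 2≤n → trans (count-recurrence (true ∷ []) n (inj₂ ([] , refl)) 2≤n) (regroup (count (true ∷ []) n) (count (false ∷ []) n)))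
    (one-shorter-∷ʳ-false (true ∷ []) [] ih refl ∷ [])
    where
    regroup : ∀ c f → 0 + ((c + (f + 0)) + c) ≡ (c + c) + (f + 0)
    regroup = solve 2 (λ c f → con 0 :+ ((c :+ (f :+ con 0)) :+ c) := (c :+ c) :+ (f :+ con 0)) refl

  annihilated-step : ∀ σ → ShorterAnnihilated σ → AnnihilatedCount σ (suc (length σ))
  annihilated-step σ ih with adjacentPeaks σ in adj
  ... | true  = annihilated-zero _ (λ n _ → cong toℚ (count-adjacentPeaks σ n adj))
  ... | false with initLast σ
  ...   | []          = annihilated-[]
  ...   | ρ ∷ʳ′ false = one-shorter-∷ʳ-false (ρ ∷ʳ false) ρ ih (sym (length-∷ʳ ρ false))
  ...   | ρ ∷ʳ′ true with initLast ρ
  ...     | []           = annihilated-[true] ih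
  ...     | ρ′ ∷ʳ′ true  = ⊥-elim (true≢false (trans (sym (adjacentPeaks-TT ρ′)) (trans (cong adjacentPeaks TT-≡) adj)))
    where
    TT-≡ : ρ′ ++ true ∷ true ∷ [] ≡ (ρ′ ∷ʳ true) ∷ʳ true
    TT-≡ = sym (LP.∷ʳ-++ ρ′ true (true ∷ []))
    true≢false : true ≢ false
    true≢false ()
  ...     | ρ′ ∷ʳ′ false =
          subst (λ τ → AnnihilatedCount τ (suc (length τ))) FT-≡ (annihilated-⁺ ρ′ (subst ShorterAnnihilated (sym FT-≡) ih))
    where
    FT-≡ : ρ′ ⁺ ≡ (ρ′ ∷ʳ false) ∷ʳ true
    FT-≡ = sym (LP.∷ʳ-++ ρ′ false (true ∷ []))

  count-annihilated : ∀ σ → AnnihilatedCount σ (suc (length σ))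
  count-annihilated σ = bounded (length σ) σ ℕP.≤-refl
    where
    bounded : ∀ N σ → length σ ≤ N → AnnihilatedCount σ (suc (length σ))
    bounded zero    σ ∣σ∣≤0   = annihilated-step σ (λ τ ∣τ∣<∣σ∣ → ⊥-elim (ℕP.n≮0 (ℕP.<-≤-trans ∣τ∣<∣σ∣ ∣σ∣≤0)))
    bounded (suc N) σ ∣σ∣≤1+N = annihilated-step σ (λ τ ∣τ∣<∣σ∣ → bounded N τ (ℕP.≤-pred (ℕP.≤-trans ∣τ∣<∣σ∣ ∣σ∣≤1+N)))

-- Peak sets versus peak words: a strictly increasing S ⊆ {2, 3, …} is the set of positions
-- of the trues in its pattern, which ends with a peak and has length max S − 1.
module PeakSets where
  open import Data.Nat as ℕ using (zero; suc; _≤_; z≤n; s≤s; _+_; _⊔_; _<?_)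
  import Data.Nat.Properties as ℕP
  open import Data.Bool using (Bool; true; false; _∧_; if_then_else_)
  open import Data.List using (_∷_; _++_; _∷ʳ_; replicate)
  import Data.List.Properties as LP
  open import Data.List.Relation.Unary.All as All using (All; []; _∷_)
  open import Data.List.Relation.Unary.AllPairs using (AllPairs; []; _∷_)
  open import Data.Product using (Σ; _,_; _×_; proj₂)
  open import Data.Empty using (⊥-elim)
  open import Relation.Nullary.Decidable using (⌊_⌋)
  open import Relation.Binary.PropositionalEquality
  open Sums
  open PeakWords
  open InsertingTheLargestLetter

  positions : ℕ → List Bool → List ℕ
  positions k []           = []
  positions k (true ∷ bs)  = k ∷ positions (suc k) bs
  positions k (false ∷ bs) = positions (suc k) bs

  positions-∷ : ∀ k b bs → positions k (b ∷ bs) ≡ (if b then k ∷ positions (suc k) bs else positions (suc k) bs)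
  positions-∷ k true  bs = refl
  positions-∷ k false bs = refl

  peaksFrom-positions : ∀ i w → peaksFrom i w ≡ positions (suc i) (peakBits w)
  peaksFrom-positions i []              = refl
  peaksFrom-positions i (a ∷ [])        = refl
  peaksFrom-positions i (a ∷ b ∷ [])    = refl
  peaksFrom-positions i (a ∷ b ∷ c ∷ r) =
    trans (cong (λ ps → if peakBit a b c then suc i ∷ ps else ps) (peaksFrom-positions (suc i) (b ∷ c ∷ r)))
          (sym (positions-∷ (suc i) (peakBit a b c) (peakBits (b ∷ c ∷ r))))

  positions-lowerBound : ∀ k e → All (k ≤_) (positions k e)
  positions-lowerBound k []           = []
  positions-lowerBound k (true ∷ e)  = ℕP.≤-refl ∷ All.map ℕP.<⇒≤ (positions-lowerBound (suc k) e)
  positions-lowerBound k (false ∷ e) = All.map ℕP.<⇒≤ (positions-lowerBound (suc k) e)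

  length-positions : ∀ k e → length (positions k e) ≤ length e
  length-positions k []           = z≤n
  length-positions k (true ∷ e)  = s≤s (length-positions (suc k) e)
  length-positions k (false ∷ e) = ℕP.m≤n⇒m≤1+n (length-positions (suc k) e)

  positions-matches : ∀ k σ e → matches σ e ≡ true → positions k e ≡ positions k σ
  positions-matches k []      e       m = allFalse-positions k e m
    where
    allFalse-positions : ∀ k e → allFalse e ≡ true → positions k e ≡ []
    allFalse-positions k []          _ = refl
    allFalse-positions k (false ∷ e) m = allFalse-positions (suc k) e m
  positions-matches k (s ∷ σ) (b ∷ e) m with s | b | m
  ... | true  | true  | m′ = cong (k ∷_) (positions-matches (suc k) σ e m′)
  ... | false | false | m′ = positions-matches (suc k) σ e m′
  ... | true  | false | ()
  ... | false | true  | ()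

  too-small : ∀ k ps e → k ∷ ps ≢ positions (suc k) e
  too-small k ps e eq with subst (All (suc k ≤_)) (sym eq) (positions-lowerBound (suc k) e)
  ... | k<k ∷ _ = ℕP.<-irrefl refl k<k

  matches-positions : ∀ k ρ e → positions k e ≡ positions k (ρ ∷ʳ true) → matches (ρ ∷ʳ true) e ≡ true
  matches-positions k []          []          ()
  matches-positions k []          (true ∷ e)  eq = positions-allFalse (suc k) e (proj₂ (LP.∷-injective eq))
    where
    positions-allFalse : ∀ k e → positions k e ≡ [] → allFalse e ≡ true
    positions-allFalse k []          _  = refl
    positions-allFalse k (false ∷ e) eq = positions-allFalse (suc k) e eq
  matches-positions k []          (false ∷ e) eq = ⊥-elim (too-small k [] e (sym eq))
  matches-positions k (r ∷ ρ)     []          eq = ⊥-elim (nonempty k (r ∷ ρ) (sym eq))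
    where
    nonempty : ∀ k ρ → positions k (ρ ∷ʳ true) ≢ []
    nonempty k []          ()
    nonempty k (true ∷ ρ)  ()
    nonempty k (false ∷ ρ) eq = nonempty (suc k) ρ eq
  matches-positions k (true ∷ ρ)  (true ∷ e)  eq = matches-positions (suc k) ρ e (proj₂ (LP.∷-injective eq))
  matches-positions k (false ∷ ρ) (false ∷ e) eq = matches-positions (suc k) ρ e eq
  matches-positions k (true ∷ ρ)  (false ∷ e) eq = ⊥-elim (too-small k _ e (sym eq))
  matches-positions k (false ∷ ρ) (true ∷ e)  eq = ⊥-elim (too-small k _ (ρ ∷ʳ true) eq)

  patternOf : ℕ → List ℕ → List Bool
  patternOf k []      = []
  patternOf k (s ∷ S) = replicate (s ∸ k) false ++ true ∷ patternOf (suc s) S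

  positions-replicate : ∀ k j bs → positions k (replicate j false ++ bs) ≡ positions (j + k) bs
  positions-replicate k zero    bs = refl
  positions-replicate k (suc j) bs = trans (positions-replicate (suc k) j bs) (cong (λ i → positions i bs) (ℕP.+-suc j k))

  positions-patternOf : ∀ k S → All (k ≤_) S → AllPairs _<_ S → positions k (patternOf k S) ≡ S
  positions-patternOf k []      _          _          = refl
  positions-patternOf k (s ∷ S) (k≤s ∷ _) (s<S ∷ S↑)
    rewrite positions-replicate k (s ∸ k) (true ∷ patternOf (suc s) S) | ℕP.m∸n+n≡m k≤s =
    cong (s ∷_) (positions-patternOf (suc s) S s<S S↑)

  patternOf-endsWithPeak : ∀ k s S → Σ (List Bool) (λ ρ → patternOf k (s ∷ S) ≡ ρ ∷ʳ true)
  patternOf-endsWithPeak k s []        = replicate (s ∸ k) false , refl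
  patternOf-endsWithPeak k s (s′ ∷ S) with patternOf-endsWithPeak (suc s) s′ S
  ... | ρ , eq = replicate (s ∸ k) false ++ true ∷ ρ ,
                 trans (cong (λ bs → replicate (s ∸ k) false ++ true ∷ bs) eq)
                       (sym (LP.++-assoc (replicate (s ∸ k) false) (true ∷ ρ) (true ∷ [])))

  maxL-positions : ∀ k ρ → maxL (positions k (ρ ∷ʳ true)) ≡ k + length ρ
  maxL-positions k []          = trans (ℕP.⊔-identityʳ k) (sym (ℕP.+-identityʳ k))
  maxL-positions k (true ∷ ρ)  =
    trans (cong (k ⊔_) (maxL-positions (suc k) ρ))
          (trans (ℕP.m≤n⇒m⊔n≡n (ℕP.≤-trans (ℕP.n≤1+n k) (ℕP.m≤m+n (suc k) (length ρ)))) (sym (ℕP.+-suc k (length ρ))))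
  maxL-positions k (false ∷ ρ) = trans (maxL-positions (suc k) ρ) (sym (ℕP.+-suc k (length ρ)))

  countP-count : ∀ S n ρ → patternOf 2 S ≡ ρ ∷ʳ true → positions 2 (patternOf 2 S) ≡ S → countP S n ≡ count (patternOf 2 S) n
  countP-count S n ρ σ≡ρT positions-σ =
    length-filter-indicator (λ w → LP.≡-dec ℕ._≟_ (peaks w) S) (λ w → hits σ (peakBits w)) indicator (perms n)
    where
    σ = patternOf 2 S
    indicator : ∀ w → (peaks w ≡ S → hits σ (peakBits w) ≡ 1) × (peaks w ≢ S → hits σ (peakBits w) ≡ 0)
    indicator w = hit , miss
      where
      hit : peaks w ≡ S → hits σ (peakBits w) ≡ 1
      hit peaks≡S = cong (λ b → if b then 1 else 0) (subst (λ τ → matches τ (peakBits w) ≡ true) (sym σ≡ρT)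
        (matches-positions 2 ρ (peakBits w)
          (trans (sym (peaksFrom-positions 1 w)) (trans peaks≡S (trans (sym positions-σ) (cong (positions 2) σ≡ρT))))))
      miss : peaks w ≢ S → hits σ (peakBits w) ≡ 0
      miss peaks≢S with matches σ (peakBits w) in m
      ... | true  = ⊥-elim (peaks≢S (trans (peaksFrom-positions 1 w) (trans (positions-matches 2 σ (peakBits w) m) positions-σ)))
      ... | false = refl

  PeakBounds : ℕ → ℕ → ℕ → Set
  PeakBounds i len p = i < p × suc p < i + len

  peakBounds-suc : ∀ i len ps → All (PeakBounds (suc i) len) ps → All (PeakBounds i (suc len)) ps
  peakBounds-suc i len ps = All.map (λ {p} (i<p , p<) → ℕP.<⇒≤ i<p , subst (suc p <_) (sym (ℕP.+-suc i len)) p<)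

  peaksFrom-bounds : ∀ i w → All (PeakBounds i (length w)) (peaksFrom i w)
  peaksFrom-bounds i []              = []
  peaksFrom-bounds i (a ∷ [])        = []
  peaksFrom-bounds i (a ∷ b ∷ [])    = []
  peaksFrom-bounds i (a ∷ b ∷ c ∷ r) =
    add-first (⌊ a <? b ⌋ ∧ ⌊ c <? b ⌋) (peakBounds-suc i _ _ (peaksFrom-bounds (suc i) (b ∷ c ∷ r)))
    where
    first : suc (suc i) < i + length (a ∷ b ∷ c ∷ r)
    first = ℕP.≤-trans (ℕP.m≤m+n (3 + i) (length r))
                       (ℕP.≤-reflexive (trans (cong (_+ length r) (ℕP.+-comm 3 i)) (ℕP.+-assoc i 3 (length r))))
    add-first : ∀ t {ps} → All (PeakBounds i (length (a ∷ b ∷ c ∷ r))) ps →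
                All (PeakBounds i (length (a ∷ b ∷ c ∷ r))) (if t then suc i ∷ ps else ps)
    add-first true  ps-bounds = (ℕP.≤-refl , first) ∷ ps-bounds
    add-first false ps-bounds = ps-bounds

  maxL-< : ∀ {n} s S → All (_< n) (s ∷ S) → maxL (s ∷ S) < n
  maxL-< s []      (s<n ∷ []) = ℕP.⊔-lub s<n (ℕP.≤-trans (s≤s z≤n) s<n)
  maxL-< s (t ∷ S) (s<n ∷ S<n) = ℕP.⊔-lub s<n (maxL-< t S S<n)

  countP-zero : ∀ S n → (∀ w → length w ≡ n → peaks w ≢ S) → countP S n ≡ 0
  countP-zero S n unrealised = cong length (LP.filter-none (λ w → LP.≡-dec ℕ._≟_ (peaks w) S)
    (All.map (λ {w} (∣w∣≡n , _) → unrealised w ∣w∣≡n) (perms-shape n)))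

-- The theorem: by the bounds on peaks #P(S;n) vanishes at n = max S (and everywhere if min S < 2);
-- otherwise it is annihilated from max S, and constant-coefficient-zero applies.
module ConstantCoefficient where
  open import Data.Nat as ℕ using (suc; _≤_; s≤s; _+_)
  import Data.Nat.Properties as ℕP
  open import Data.Bool using (Bool; true)
  open import Data.List using (_∷_; _∷ʳ_)
  open import Data.List.Relation.Unary.All as All using (All; _∷_)
  open import Data.List.Relation.Unary.AllPairs as AllPairs using (AllPairs)
  open import Data.Product using (_,_; proj₁; proj₂)
  open import Data.Rational using (1ℚ; _*_)
  import Data.Rational.Properties as ℚP
  open import Relation.Nullary using (¬_)
  open import Relation.Binary.PropositionalEquality
  open NatToRational
  open Annihilation
  open BinomialExpansions
  open InsertingTheLargestLetter
  open CountsAreAnnihilated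
  open PeakSets

  Expansion : List ℕ → List ℚ → Set
  Expansion S cs = ∀ n → maxL S < n → toℚ (countP S n) ≡ evalBinom cs (n ∸ maxL S) * toℚ (2 ^ (n ∸ length S ∸ 1))

  -- No permutation of {1,…,max S} has its peak set equal to S (max S is the last position).
  countP-at-max : ∀ s S → countP (s ∷ S) (maxL (s ∷ S)) ≡ 0
  countP-at-max s S = countP-zero (s ∷ S) (maxL (s ∷ S)) λ w ∣w∣≡m peaks≡S →
    ℕP.<-irrefl (sym ∣w∣≡m) (maxL-< s S (subst (All (_< length w)) peaks≡S
      (All.map (λ (_ , p<) → ℕP.≤-pred p<) (peaksFrom-bounds 1 w))))

  -- Position 1 is never a peak.
  countP-below-2 : ∀ s S → ¬ (2 ≤ s) → ∀ n → countP (s ∷ S) n ≡ 0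
  countP-below-2 s S s<2 n = countP-zero (s ∷ S) n λ w _ peaks≡S →
    s<2 (All.head (subst (All (1 <_)) peaks≡S (All.map proj₁ (peaksFrom-bounds 1 w))))

  -- The two cases of the proof.  If the count is annihilated from m = max S, vanishes at m,
  -- and |S| < m, then 2^(n−|S|−1) = 2^(m−|S|−1)·2^(n−m) and constant-coefficient-zero applies.
  coeff-zero-annihilated : ∀ S cs → length S < maxL S → Annihilated (λ n → toℚ (countP S n)) (maxL S) →
    countP S (maxL S) ≡ 0 → Expansion S cs → coeff cs 0 ≡ 0ℚ
  coeff-zero-annihilated S cs ∣S∣<m count-ann count-m expansion =
    constant-coefficient-zero (λ n → toℚ (countP S n)) m cs c (toℚ-nonZero (2 ^ j) (ℕP.m^n≢0 2 j))
                              count-ann (cong toℚ count-m) agree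
    where
    m = maxL S
    j = m ∸ length S ∸ 1
    c = toℚ (2 ^ j)
    exponent : ∀ x → x + m ∸ length S ∸ 1 ≡ x + j
    exponent x = trans (cong (_∸ 1) (ℕP.+-∸-assoc x (ℕP.<⇒≤ ∣S∣<m))) (ℕP.+-∸-assoc x (ℕP.m<n⇒0<n∸m ∣S∣<m))
    agree : ∀ x → 1 ≤ x → toℚ (countP S (x + m)) ≡ c * expBinom cs x
    agree x 1≤x = begin
      toℚ (countP S (x + m))                              ≡⟨ expansion (x + m) (ℕP.+-monoˡ-≤ m 1≤x) ⟩
      evalBinom cs (x + m ∸ m) * toℚ (2 ^ (x + m ∸ length S ∸ 1))
        ≡⟨ cong₂ (λ y k → evalBinom cs y * toℚ (2 ^ k)) (ℕP.m+n∸n≡m x m) (exponent x) ⟩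
      evalBinom cs x * toℚ (2 ^ (x + j))                  ≡⟨ cong (λ z → evalBinom cs x * toℚ z) (ℕP.^-distribˡ-+-* 2 x j) ⟩
      evalBinom cs x * toℚ (2 ^ x ℕ.* 2 ^ j)              ≡⟨ cong (evalBinom cs x *_) (toℚ-* (2 ^ x) (2 ^ j)) ⟩
      evalBinom cs x * (toℚ (2 ^ x) * c)                  ≡⟨ sym (ℚP.*-assoc (evalBinom cs x) _ c) ⟩
      expBinom cs x * c                                   ≡⟨ ℚP.*-comm (expBinom cs x) c ⟩
      c * expBinom cs x                                   ∎
      where open ≡-Reasoning

  -- If no permutation has peak set S, the expansion forces p(x) = 0 for all x ≥ 1.
  coeff-zero-unrealised : ∀ S cs → (∀ n → countP S n ≡ 0) → Expansion S cs → coeff cs 0 ≡ 0ℚ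
  coeff-zero-unrealised S cs count≡0 expansion =
    constant-coefficient-zero (λ n → toℚ (countP S n)) m cs 1ℚ _
      (annihilated-zero m (λ n _ → cong toℚ (count≡0 n))) (cong toℚ (count≡0 m)) agree
    where
    m = maxL S
    p≡0 : ∀ x → 1 ≤ x → evalBinom cs x ≡ 0ℚ
    p≡0 x 1≤x = 2^-cancel (x + m ∸ length S ∸ 1) (evalBinom cs x)
      (trans (ℚP.*-comm _ (evalBinom cs x))
             (sym (trans (cong toℚ (sym (count≡0 (x + m))))
                         (trans (expansion (x + m) (ℕP.+-monoˡ-≤ m 1≤x))
                                (cong (λ y → evalBinom cs y * toℚ (2 ^ (x + m ∸ length S ∸ 1))) (ℕP.m+n∸n≡m x m))))))
    agree : ∀ x → 1 ≤ x → toℚ (countP S (x + m)) ≡ 1ℚ * expBinom cs x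
    agree x 1≤x = trans (cong toℚ (count≡0 (x + m)))
      (sym (trans (ℚP.*-identityˡ (expBinom cs x)) (trans (cong (_* toℚ (2 ^ x)) (p≡0 x 1≤x)) (ℚP.*-zeroˡ (toℚ (2 ^ x))))))

  module ViaPattern (s : ℕ) (S′ : List ℕ) (2≤s : 2 ≤ s) (S↑ : AllPairs _<_ (s ∷ S′)) where
    S : List ℕ
    S = s ∷ S′

    σ : List Bool
    σ = patternOf 2 S

    ρ : List Bool
    ρ = proj₁ (patternOf-endsWithPeak 2 s S′)

    σ≡ρ∷ʳtrue : σ ≡ ρ ∷ʳ true
    σ≡ρ∷ʳtrue = proj₂ (patternOf-endsWithPeak 2 s S′)

    positions-σ : positions 2 σ ≡ S
    positions-σ = positions-patternOf 2 S (2≤s ∷ All.map (λ s<t → ℕP.≤-trans 2≤s (ℕP.<⇒≤ s<t)) (AllPairs.head S↑)) S↑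

    maxL≡1+∣σ∣ : maxL S ≡ suc (length σ)
    maxL≡1+∣σ∣ = begin
      maxL S                          ≡⟨ cong maxL (sym positions-σ) ⟩
      maxL (positions 2 σ)            ≡⟨ cong (λ τ → maxL (positions 2 τ)) σ≡ρ∷ʳtrue ⟩
      maxL (positions 2 (ρ ∷ʳ true))  ≡⟨ maxL-positions 2 ρ ⟩
      suc (suc (length ρ))            ≡⟨ cong suc (sym (trans (cong length σ≡ρ∷ʳtrue) (length-∷ʳ ρ true))) ⟩
      suc (length σ)                  ∎
      where open ≡-Reasoning

    ∣S∣<maxL : length S < maxL S
    ∣S∣<maxL = subst (length S <_) (sym maxL≡1+∣σ∣) (s≤s (subst (λ T → length T ≤ length σ) positions-σ (length-positions 2 σ)))

    countP-annihilated : Annihilated (λ n → toℚ (countP S n)) (maxL S)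
    countP-annihilated = subst (Annihilated _) (sym maxL≡1+∣σ∣)
      (annihilated-cong (λ n _ → cong toℚ (sym (countP-count S n ρ σ≡ρ∷ʳtrue positions-σ))) (count-annihilated σ))

open ConstantCoefficient using (countP-below-2; countP-at-max; coeff-zero-unrealised; coeff-zero-annihilated; module ViaPattern)

lemma5p2 : (S : List ℕ) → S ≢ [] → IsFinSetPos S →
    (C : List ℚ) →
    (∀ n → maxL S < n →
    toℚ (countP S n) ≡ evalBinom C (n ∸ maxL S) *ℚ toℚ (2 ^ (n ∸ length S ∸ 1))) →
    coeff C 0 ≡ 0ℚ
lemma5p2 []      S≢[] _        C expansion = ⊥-elim (S≢[] refl)
lemma5p2 (s ∷ S) _    (S↑ , _) C expansion with 2 ≤? s
... | no  s<2 = coeff-zero-unrealised (s ∷ S) C (countP-below-2 s S s<2) expansion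
... | yes 2≤s = coeff-zero-annihilated (s ∷ S) C ∣S∣<maxL countP-annihilated (countP-at-max s S) expansion
  where open ViaPattern s S 2≤s S↑ using (∣S∣<maxL; countP-annihilated)
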